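{- Let $p\ge 2$ and $n\ge p$ be integers. Then $$\binom{n}{p}\sum_{k=p}^{\infty}\frac{W_p(k)}{k(k+1)\cdots(k+n)}=\sum_{k=p}^{\infty}\frac{1}{k(k+1)\cdots(k+n-p)}\begin{bmatrix}k\\ p\end{bmatrix}\frac{1}{k!},$$ where $W_p(k)=\sum_{k_1+\dots+k_p=k,\ k_j\ge1}H_{k_1}\cdots H_{k_p}$.
   Context: $H_k=1+\frac12+\dots+\frac1k$ are the harmonic numbers. $\begin{bmatrix}k\\ p\end{bmatrix}$ denotes the unsigned Stirling number of the first kind (number of permutations of $k$ elements with exactly $p$ cycles). When $n=p$ the product $k(k+1)\cdots(k+n-p)$ equals $k$. -}

module Defs where

open import Data.Nat as ℕ using (ℕ; zero; suc; _∸_; _!)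
open import Data.Nat.Combinatorics using (_C_)
open import Data.List using (List; []; _∷_; map; concatMap; sum; product)
open import Data.Integer using (+_)
open import Data.Rational using (ℚ; 0ℚ; 1ℚ; _+_; _*_; _-_; _/_; ∣_∣; _<_)
open import Data.Product using (∃-syntax; _×_)

ℕ→ℚ : ℕ → ℚ
ℕ→ℚ m = + m / 1

-- 1/m for positive m (inv 0 = 0 by convention; never used at 0 below)
inv : ℕ → ℚ
inv zero    = 0ℚ
inv (suc m) = + 1 / suc m

H : ℕ → ℚ
H zero    = 0ℚ
H (suc k) = H k + inv (suc k)

oneTo : ℕ → List ℕ
oneTo zero    = []
oneTo (suc k) = Data.List._++_ (oneTo k) (suc k ∷ [])

compositions : ℕ → ℕ → List (List ℕ)
compositions zero zero        = [] ∷ []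
compositions zero (suc _)     = []
compositions (suc p) k =
  concatMap (λ j → map (j ∷_) (compositions p (k ∸ j))) (oneTo k)

prodℚ : List ℚ → ℚ
prodℚ []       = 1ℚ
prodℚ (x ∷ xs) = x * prodℚ xs

sumℚ : List ℚ → ℚ
sumℚ []       = 0ℚ
sumℚ (x ∷ xs) = x + sumℚ xs

W : ℕ → ℕ → ℚ
W p k = sumℚ (map (λ c → prodℚ (map H c)) (compositions p k))

stirling1 : ℕ → ℕ → ℕ
stirling1 zero    zero    = 1
stirling1 zero    (suc _) = 0
stirling1 (suc _) zero    = 0
stirling1 (suc n) (suc k) = n ℕ.* stirling1 n (suc k) ℕ.+ stirling1 n k

risingProd : ℕ → ℕ → ℕ
risingProd k zero    = k
risingProd k (suc m) = risingProd k m ℕ.* (k ℕ.+ suc m)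

partialSum : (ℕ → ℚ) → ℕ → ℚ
partialSum f zero    = 0ℚ
partialSum f (suc M) = partialSum f M + f M

lhsTerm : ℕ → ℕ → ℕ → ℚ
lhsTerm p n k = W p k * inv (risingProd k n)

rhsTerm : ℕ → ℕ → ℕ → ℚ
rhsTerm p n k = inv (risingProd k (n ∸ p)) * ℕ→ℚ (stirling1 k p) * inv (k !)

lhsPartial : ℕ → ℕ → ℕ → ℚ
lhsPartial p n M = ℕ→ℚ (n C p) * partialSum (λ i → lhsTerm p n (p ℕ.+ i)) M

rhsPartial : ℕ → ℕ → ℕ → ℚ
rhsPartial p n M = partialSum (λ i → rhsTerm p n (p ℕ.+ i)) M

-- a rational sequence is Cauchy (i.e. converges in ℝ)
Cauchy : (ℕ → ℚ) → Set
Cauchy s = ∀ ε → 0ℚ < ε → ∃[ N ] (∀ a b → N ℕ.≤ a → N ℕ.≤ b → ∣ s a - s b ∣ < ε)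

-- two sequences have difference tending to 0 (same limit)
SameLimit : (ℕ → ℚ) → (ℕ → ℚ) → Set
SameLimit s t = ∀ ε → 0ℚ < ε → ∃[ N ] (∀ m → N ℕ.≤ m → ∣ s m - t m ∣ < ε)

-- Σ H_k x^k = L(x)/(1-x) with L(x) = -log(1-x), so W_p has generating function (L/(1-x))^p: W_p is p! times
-- the p-fold partial summation of s_p(k) = [k p]/k!, the coefficients of L^p/p!. Summation by parts against
-- 1/(k(k+1)⋯(k+m)), whose differences are (m+1)/(k(k+1)⋯(k+m+1)), undoes one partial summation and shortens the
-- rising product by one factor; after p steps, since C(n,p) p! = (m+1)(m+2)⋯n with m = n - p, the left-hand
-- partial sums turn into the right-hand ones up to boundary terms of size O(H_K^p / K). These vanish in the limit,
-- and the right-hand terms are O(H_k^(p-1) / k²), which makes both series converge.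

module Submission where

open import Algebra.Bundles using (CommutativeRing)
open import Data.Empty using (⊥-elim)
import Data.Integer as ℤ
import Data.Integer.Properties as ℤₚ
import Data.Integer.Tactic.RingSolver as ℤ-Solver
open import Data.List using (List; []; _∷_; _++_; map; concatMap)
import Data.List.Properties as List
open import Data.Nat as ℕ using (ℕ; zero; suc; _∸_; _!; z≤n; s≤s)
open import Data.Nat.Combinatorics using (_C_)
import Data.Nat.Combinatorics as ℕC
import Data.Nat.DivMod as ℕD
import Data.Nat.Properties as ℕₚ
open import Data.Product using (∃-syntax; _×_; _,_)
open import Data.Rational
open import Data.Rational.Properties
import Data.Rational.Unnormalised as ℚᵘ
import Data.Rational.Unnormalised.Properties as ℚᵘₚ
open import Data.Sum using (inj₁; inj₂)
open import Function using (_∘_)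
open import Relation.Binary.PropositionalEquality
open import Relation.Nullary using (yes; no)
open import Relation.Nullary.Decidable using (dec⇒maybe)
open import Tactic.RingSolver using (solve-∀)
open import Tactic.RingSolver.Core.AlmostCommutativeRing using (AlmostCommutativeRing; fromCommutativeRing)
open import Algebra.Properties.Semiring.Exp (CommutativeRing.semiring +-*-commutativeRing) using (_^_; ^-homo-*)

open import Defs

ℚ-ring : AlmostCommutativeRing _ _
ℚ-ring = fromCommutativeRing +-*-commutativeRing (λ x → dec⇒maybe (0ℚ ≟ x))

toℚᵘ-ℕ→ℚ : ∀ m → toℚᵘ (ℕ→ℚ m) ℚᵘ.≃ ℚᵘ.mkℚᵘ (ℤ.+ m) 0
toℚᵘ-ℕ→ℚ m = toℚᵘ-fromℚᵘ (ℚᵘ.mkℚᵘ (ℤ.+ m) 0)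

toℚᵘ-inv : ∀ m → toℚᵘ (inv (suc m)) ℚᵘ.≃ ℚᵘ.mkℚᵘ (ℤ.+ 1) m
toℚᵘ-inv m = toℚᵘ-fromℚᵘ (ℚᵘ.mkℚᵘ (ℤ.+ 1) m)

ℕ→ℚ-+ : ∀ a b → ℕ→ℚ (a ℕ.+ b) ≡ ℕ→ℚ a + ℕ→ℚ b
ℕ→ℚ-+ a b = toℚᵘ-injective (begin
  toℚᵘ (ℕ→ℚ (a ℕ.+ b))                              ≈⟨ toℚᵘ-ℕ→ℚ (a ℕ.+ b) ⟩
  ℚᵘ.mkℚᵘ (ℤ.+ (a ℕ.+ b)) 0                          ≈⟨ ℚᵘ.*≡* eq ⟩
  ℚᵘ.mkℚᵘ (ℤ.+ a) 0 ℚᵘ.+ ℚᵘ.mkℚᵘ (ℤ.+ b) 0            ≈⟨ ℚᵘₚ.+-cong (toℚᵘ-ℕ→ℚ a) (toℚᵘ-ℕ→ℚ b) ⟨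
  toℚᵘ (ℕ→ℚ a) ℚᵘ.+ toℚᵘ (ℕ→ℚ b)                    ≈⟨ toℚᵘ-homo-+ (ℕ→ℚ a) (ℕ→ℚ b) ⟨
  toℚᵘ (ℕ→ℚ a + ℕ→ℚ b)                              ∎)
  where
  open ℚᵘₚ.≃-Reasoning
  eq : ℤ.+ (a ℕ.+ b) ℤ.* ℤ.1ℤ ≡ (ℤ.+ a ℤ.* ℤ.1ℤ ℤ.+ ℤ.+ b ℤ.* ℤ.1ℤ) ℤ.* ℤ.1ℤ
  eq = trans (cong (ℤ._* ℤ.1ℤ) (ℤₚ.pos-+ a b)) (ring (ℤ.+ a) (ℤ.+ b))
    where ring : ∀ x y → (x ℤ.+ y) ℤ.* ℤ.1ℤ ≡ (x ℤ.* ℤ.1ℤ ℤ.+ y ℤ.* ℤ.1ℤ) ℤ.* ℤ.1ℤ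
          ring = ℤ-Solver.solve-∀

ℕ→ℚ-* : ∀ a b → ℕ→ℚ (a ℕ.* b) ≡ ℕ→ℚ a * ℕ→ℚ b
ℕ→ℚ-* a b = toℚᵘ-injective (begin
  toℚᵘ (ℕ→ℚ (a ℕ.* b))                              ≈⟨ toℚᵘ-ℕ→ℚ (a ℕ.* b) ⟩
  ℚᵘ.mkℚᵘ (ℤ.+ (a ℕ.* b)) 0                          ≈⟨ ℚᵘ.*≡* (cong (ℤ._* ℤ.1ℤ) (ℤₚ.pos-* a b)) ⟩
  ℚᵘ.mkℚᵘ (ℤ.+ a) 0 ℚᵘ.* ℚᵘ.mkℚᵘ (ℤ.+ b) 0            ≈⟨ ℚᵘₚ.*-cong (toℚᵘ-ℕ→ℚ a) (toℚᵘ-ℕ→ℚ b) ⟨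
  toℚᵘ (ℕ→ℚ a) ℚᵘ.* toℚᵘ (ℕ→ℚ b)                    ≈⟨ toℚᵘ-homo-* (ℕ→ℚ a) (ℕ→ℚ b) ⟨
  toℚᵘ (ℕ→ℚ a * ℕ→ℚ b)                              ∎)
  where open ℚᵘₚ.≃-Reasoning

ℕ→ℚ-suc : ∀ m → ℕ→ℚ (suc m) ≡ 1ℚ + ℕ→ℚ m
ℕ→ℚ-suc m = ℕ→ℚ-+ 1 m

ℕ→ℚ*inv≡1 : ∀ m → ℕ→ℚ (suc m) * inv (suc m) ≡ 1ℚ
ℕ→ℚ*inv≡1 m = toℚᵘ-injective (begin
  toℚᵘ (ℕ→ℚ (suc m) * inv (suc m))                  ≈⟨ toℚᵘ-homo-* (ℕ→ℚ (suc m)) (inv (suc m)) ⟩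
  toℚᵘ (ℕ→ℚ (suc m)) ℚᵘ.* toℚᵘ (inv (suc m))        ≈⟨ ℚᵘₚ.*-cong (toℚᵘ-ℕ→ℚ (suc m)) (toℚᵘ-inv m) ⟩
  ℚᵘ.mkℚᵘ (ℤ.+ suc m) 0 ℚᵘ.* ℚᵘ.mkℚᵘ (ℤ.+ 1) m        ≈⟨ ℚᵘ.*≡* (ring (ℤ.+ suc m)) ⟩
  toℚᵘ 1ℚ                                           ∎)
  where
  open ℚᵘₚ.≃-Reasoning
  ring : ∀ x → (x ℤ.* ℤ.1ℤ) ℤ.* ℤ.1ℤ ≡ ℤ.1ℤ ℤ.* (ℤ.1ℤ ℤ.* x)
  ring = ℤ-Solver.solve-∀

inv-* : ∀ a b → inv (a ℕ.* b) ≡ inv a * inv b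
inv-* zero    b       = sym (*-zeroˡ (inv b))
inv-* (suc a) zero    = trans (cong inv (ℕₚ.*-zeroʳ a)) (sym (*-zeroʳ (inv (suc a))))
inv-* (suc a) (suc b) = toℚᵘ-injective (begin
  toℚᵘ (inv (suc a ℕ.* suc b))                     ≈⟨ toℚᵘ-inv (b ℕ.+ a ℕ.* suc b) ⟩
  ℚᵘ.mkℚᵘ (ℤ.+ 1) (b ℕ.+ a ℕ.* suc b)               ≈⟨ ℚᵘₚ.*-cong (toℚᵘ-inv a) (toℚᵘ-inv b) ⟨
  toℚᵘ (inv (suc a)) ℚᵘ.* toℚᵘ (inv (suc b))        ≈⟨ toℚᵘ-homo-* (inv (suc a)) (inv (suc b)) ⟨
  toℚᵘ (inv (suc a) * inv (suc b))                  ∎)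
  where open ℚᵘₚ.≃-Reasoning

0≤ℕ→ℚ : ∀ m → 0ℚ ≤ ℕ→ℚ m
0≤ℕ→ℚ m = nonNegative⁻¹ (ℕ→ℚ m) {{normalize-nonNeg m 1}}

0<inv[1+m] : ∀ m → 0ℚ < inv (suc m)
0<inv[1+m] m = positive⁻¹ (inv (suc m)) {{normalize-pos 1 (suc m)}}

0≤inv : ∀ m → 0ℚ ≤ inv m
0≤inv zero    = ≤-refl
0≤inv (suc m) = <⇒≤ (0<inv[1+m] m)

*-monoˡ-≤-0≤ : ∀ {r p q} → 0ℚ ≤ r → p ≤ q → r * p ≤ r * q
*-monoˡ-≤-0≤ {r} 0≤r = *-monoˡ-≤-nonNeg r {{nonNegative 0≤r}}

*-monoʳ-≤-0≤ : ∀ {r p q} → 0ℚ ≤ r → p ≤ q → p * r ≤ q * r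
*-monoʳ-≤-0≤ {r} 0≤r = *-monoʳ-≤-nonNeg r {{nonNegative 0≤r}}

*-mono-≤-0≤ : ∀ {p q r s} → 0ℚ ≤ p → 0ℚ ≤ r → p ≤ q → r ≤ s → p * r ≤ q * s
*-mono-≤-0≤ 0≤p 0≤r p≤q r≤s = ≤-trans (*-monoʳ-≤-0≤ 0≤r p≤q) (*-monoˡ-≤-0≤ (≤-trans 0≤p p≤q) r≤s)

*-nonNeg : ∀ {p q} → 0ℚ ≤ p → 0ℚ ≤ q → 0ℚ ≤ p * q
*-nonNeg {p} 0≤p 0≤q = subst (_≤ p * _) (*-zeroʳ p) (*-monoˡ-≤-0≤ 0≤p 0≤q)

+-nonNeg : ∀ {p q} → 0ℚ ≤ p → 0ℚ ≤ q → 0ℚ ≤ p + q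
+-nonNeg = +-mono-≤

p≤p+q : ∀ {p q} → 0ℚ ≤ q → p ≤ p + q
p≤p+q {p} 0≤q = subst (_≤ p + _) (+-identityʳ p) (+-monoʳ-≤ p 0≤q)

ℕ→ℚ-mono-≤ : ∀ {a b} → a ℕ.≤ b → ℕ→ℚ a ≤ ℕ→ℚ b
ℕ→ℚ-mono-≤ {a} {b} a≤b = subst (ℕ→ℚ a ≤_)
  (trans (sym (ℕ→ℚ-+ a (b ℕ.∸ a))) (cong ℕ→ℚ (ℕₚ.m+[n∸m]≡n a≤b))) (p≤p+q (0≤ℕ→ℚ (b ℕ.∸ a)))

inv-antimono-≤ : ∀ {a b} → 0 ℕ.< a → a ℕ.≤ b → inv b ≤ inv a
inv-antimono-≤ {suc a} {suc b} _ (s≤s a≤b) = toℚᵘ-cancel-≤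
  (ℚᵘₚ.≤-respʳ-≃ (ℚᵘₚ.≃-sym (toℚᵘ-inv a)) (ℚᵘₚ.≤-respˡ-≃ (ℚᵘₚ.≃-sym (toℚᵘ-inv b))
    (ℚᵘ.*≤* (ℤ.+≤+ (s≤s (ℕₚ.+-monoˡ-≤ 0 a≤b))))))

^-nonNeg : ∀ {x} n → 0ℚ ≤ x → 0ℚ ≤ x ^ n
^-nonNeg zero    _   = <⇒≤ (positive⁻¹ 1ℚ)
^-nonNeg (suc n) 0≤x = *-nonNeg 0≤x (^-nonNeg n 0≤x)

^-mono-≤ : ∀ {x y} n → 0ℚ ≤ x → x ≤ y → x ^ n ≤ y ^ n
^-mono-≤ zero    _   _   = ≤-refl
^-mono-≤ (suc n) 0≤x x≤y = *-mono-≤-0≤ 0≤x (^-nonNeg n 0≤x) x≤y (^-mono-≤ n 0≤x x≤y)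

x^[1+r]+x^r*y≤[x+y]^[1+r] : ∀ {x y} r → 0ℚ ≤ x → 0ℚ ≤ y →
  x ^ suc r + x ^ r * y ≤ (x + y) ^ suc r
x^[1+r]+x^r*y≤[x+y]^[1+r] {x} {y} zero _ _ = ≤-reflexive (ring x y)
  where ring : ∀ x y → x * 1ℚ + 1ℚ * y ≡ (x + y) * 1ℚ
        ring = solve-∀ ℚ-ring
x^[1+r]+x^r*y≤[x+y]^[1+r] {x} {y} (suc r) 0≤x 0≤y = begin
  x * x ^ suc r + x ^ suc r * y                      ≡⟨ ring x y (x ^ r) ⟩
  x * (x ^ suc r + x ^ r * y)                       ≤⟨ p≤p+q (*-nonNeg 0≤y (^-nonNeg (suc r) 0≤x)) ⟩
  x * (x ^ suc r + x ^ r * y) + y * x ^ suc r       ≤⟨ +-mono-≤ (*-monoˡ-≤-0≤ 0≤x (x^[1+r]+x^r*y≤[x+y]^[1+r] r 0≤x 0≤y))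
                                                               (*-monoˡ-≤-0≤ 0≤y (^-mono-≤ (suc r) 0≤x (p≤p+q 0≤y))) ⟩
  x * (x + y) ^ suc r + y * (x + y) ^ suc r         ≡⟨ *-distribʳ-+ ((x + y) ^ suc r) x y ⟨
  (x + y) ^ suc (suc r)                              ∎
  where
  open ≤-Reasoning
  ring : ∀ x y t → x * (x * t) + (x * t) * y ≡ x * (x * t + t * y)
  ring = solve-∀ ℚ-ring

[x+y]^[1+r]≤x^[1+r]+[1+r]*[x+y]^r*y : ∀ {x y} r → 0ℚ ≤ x → 0ℚ ≤ y →
  (x + y) ^ suc r ≤ x ^ suc r + ℕ→ℚ (suc r) * ((x + y) ^ r * y)
[x+y]^[1+r]≤x^[1+r]+[1+r]*[x+y]^r*y {x} {y} zero _ _ = ≤-reflexive (ring x y)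
  where ring : ∀ x y → (x + y) * 1ℚ ≡ x * 1ℚ + 1ℚ * (1ℚ * y)
        ring = solve-∀ ℚ-ring
[x+y]^[1+r]≤x^[1+r]+[1+r]*[x+y]^r*y {x} {y} (suc r) 0≤x 0≤y = begin
  s * s ^ suc r                                           ≤⟨ *-monoˡ-≤-0≤ 0≤s ([x+y]^[1+r]≤x^[1+r]+[1+r]*[x+y]^r*y r 0≤x 0≤y) ⟩
  s * (x ^ suc r + c * (s ^ r * y))                       ≡⟨ ring₁ x y (x ^ suc r) c (s ^ r) ⟩
  x * x ^ suc r + (y * x ^ suc r + c * (s ^ suc r * y))   ≤⟨ +-monoʳ-≤ (x * x ^ suc r)
                                                              (+-monoˡ-≤ (c * (s ^ suc r * y)) (*-monoˡ-≤-0≤ 0≤y (^-mono-≤ (suc r) 0≤x (p≤p+q 0≤y)))) ⟩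
  x * x ^ suc r + (y * s ^ suc r + c * (s ^ suc r * y))   ≡⟨ cong ((x * x ^ suc r) +_) (ring₂ y (s ^ suc r) c) ⟩
  x * x ^ suc r + (1ℚ + c) * (s ^ suc r * y)              ≡⟨ cong (λ z → x * x ^ suc r + z * (s ^ suc r * y)) (ℕ→ℚ-suc (suc r)) ⟨
  x ^ suc (suc r) + ℕ→ℚ (suc (suc r)) * (s ^ suc r * y)  ∎
  where
  open ≤-Reasoning
  s = x + y
  c = ℕ→ℚ (suc r)
  0≤s = +-nonNeg 0≤x 0≤y
  ring₁ : ∀ x y b c t → (x + y) * (b + c * (t * y)) ≡ x * b + (y * b + c * (((x + y) * t) * y))
  ring₁ = solve-∀ ℚ-ring
  ring₂ : ∀ y a c → y * a + c * (a * y) ≡ (1ℚ + c) * (a * y)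
  ring₂ = solve-∀ ℚ-ring

ℕ→ℚ[1+t]*inv[a*[1+t]]≡inv[a] : ∀ a t → ℕ→ℚ (suc t) * inv (a ℕ.* suc t) ≡ inv a
ℕ→ℚ[1+t]*inv[a*[1+t]]≡inv[a] a t = begin
  ℕ→ℚ (suc t) * inv (a ℕ.* suc t)           ≡⟨ cong (ℕ→ℚ (suc t) *_) (inv-* a (suc t)) ⟩
  ℕ→ℚ (suc t) * (inv a * inv (suc t))       ≡⟨ ring (ℕ→ℚ (suc t)) (inv a) (inv (suc t)) ⟩
  inv a * (ℕ→ℚ (suc t) * inv (suc t))       ≡⟨ cong (inv a *_) (ℕ→ℚ*inv≡1 t) ⟩
  inv a * 1ℚ                                ≡⟨ *-identityʳ (inv a) ⟩
  inv a                                     ∎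
  where
  open ≡-Reasoning
  ring : ∀ x y z → x * (y * z) ≡ y * (x * z)
  ring = solve-∀ ℚ-ring

partialSum-cong : ∀ {f g : ℕ → ℚ} M → (∀ i → i ℕ.< M → f i ≡ g i) → partialSum f M ≡ partialSum g M
partialSum-cong zero    f≡g = refl
partialSum-cong (suc M) f≡g =
  cong₂ _+_ (partialSum-cong M (λ i i<M → f≡g i (ℕₚ.m<n⇒m<1+n i<M))) (f≡g M (ℕₚ.n<1+n M))

partialSum-+ : ∀ (f g : ℕ → ℚ) M → partialSum (λ i → f i + g i) M ≡ partialSum f M + partialSum g M
partialSum-+ f g zero    = refl
partialSum-+ f g (suc M) =
  trans (cong (_+ (f M + g M)) (partialSum-+ f g M)) (ring (partialSum f M) (partialSum g M) (f M) (g M))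
  where ring : ∀ a b c d → (a + b) + (c + d) ≡ (a + c) + (b + d)
        ring = solve-∀ ℚ-ring

partialSum-*ˡ : ∀ c (f : ℕ → ℚ) M → partialSum (λ i → c * f i) M ≡ c * partialSum f M
partialSum-*ˡ c f zero    = sym (*-zeroʳ c)
partialSum-*ˡ c f (suc M) =
  trans (cong (_+ c * f M) (partialSum-*ˡ c f M)) (sym (*-distribˡ-+ c (partialSum f M) (f M)))

partialSum-≡0 : ∀ (f : ℕ → ℚ) M → (∀ i → i ℕ.< M → f i ≡ 0ℚ) → partialSum f M ≡ 0ℚ
partialSum-≡0 f M f≡0 = trans (partialSum-cong M f≡0) (partialSum-const0 M)
  where partialSum-const0 : ∀ M → partialSum (λ _ → 0ℚ) M ≡ 0ℚ
        partialSum-const0 zero    = refl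
        partialSum-const0 (suc M) = cong (_+ 0ℚ) (partialSum-const0 M)

partialSum-suc : ∀ (f : ℕ → ℚ) M → partialSum f (suc M) ≡ f 0 + partialSum (f ∘ suc) M
partialSum-suc f zero    = trans (+-identityˡ (f 0)) (sym (+-identityʳ (f 0)))
partialSum-suc f (suc M) =
  trans (cong (_+ f (suc M)) (partialSum-suc f M)) (+-assoc (f 0) (partialSum (f ∘ suc) M) (f (suc M)))

partialSum-split : ∀ (f : ℕ → ℚ) a M → partialSum f (a ℕ.+ M) ≡ partialSum f a + partialSum (λ i → f (a ℕ.+ i)) M
partialSum-split f a zero    rewrite ℕₚ.+-identityʳ a = sym (+-identityʳ (partialSum f a))
partialSum-split f a (suc M) rewrite ℕₚ.+-suc a M =
  trans (cong (_+ f (a ℕ.+ M)) (partialSum-split f a M))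
        (+-assoc (partialSum f a) (partialSum (λ i → f (a ℕ.+ i)) M) (f (a ℕ.+ M)))

partialSum-dropInitialZeros : ∀ (f : ℕ → ℚ) a M → (∀ k → k ℕ.< a → f k ≡ 0ℚ) →
  partialSum f (a ℕ.+ M) ≡ partialSum (λ i → f (a ℕ.+ i)) M
partialSum-dropInitialZeros f a M f≡0 = begin
  partialSum f (a ℕ.+ M)                            ≡⟨ partialSum-split f a M ⟩
  partialSum f a + partialSum (λ i → f (a ℕ.+ i)) M ≡⟨ cong (_+ partialSum (λ i → f (a ℕ.+ i)) M) (partialSum-≡0 f a f≡0) ⟩
  0ℚ + partialSum (λ i → f (a ℕ.+ i)) M             ≡⟨ +-identityˡ (partialSum (λ i → f (a ℕ.+ i)) M) ⟩
  partialSum (λ i → f (a ℕ.+ i)) M                  ∎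
  where open ≡-Reasoning

partialSum-reverse : ∀ (f : ℕ → ℚ) K → partialSum f (suc K) ≡ partialSum (λ j → f (K ∸ j)) (suc K)
partialSum-reverse f zero    = refl
partialSum-reverse f (suc K) = begin
  partialSum f (suc K) + f (suc K)                          ≡⟨ cong (_+ f (suc K)) (partialSum-reverse f K) ⟩
  partialSum (λ j → f (K ∸ j)) (suc K) + f (suc K)          ≡⟨ +-comm _ (f (suc K)) ⟩
  f (suc K) + partialSum (λ j → f (K ∸ j)) (suc K)          ≡⟨ partialSum-suc (λ j → f (suc K ∸ j)) (suc K) ⟨
  partialSum (λ j → f (suc K ∸ j)) (suc (suc K))            ∎
  where open ≡-Reasoning

partialSum-nonNeg : ∀ (f : ℕ → ℚ) M → (∀ i → 0ℚ ≤ f i) → 0ℚ ≤ partialSum f M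
partialSum-nonNeg f zero    0≤f = ≤-refl
partialSum-nonNeg f (suc M) 0≤f = +-nonNeg (partialSum-nonNeg f M 0≤f) (0≤f M)

partialSum-mono-≤ : ∀ (f g : ℕ → ℚ) M → (∀ i → i ℕ.< M → f i ≤ g i) → partialSum f M ≤ partialSum g M
partialSum-mono-≤ f g zero    f≤g = ≤-refl
partialSum-mono-≤ f g (suc M) f≤g =
  +-mono-≤ (partialSum-mono-≤ f g M (λ i i<M → f≤g i (ℕₚ.m<n⇒m<1+n i<M))) (f≤g M (ℕₚ.n<1+n M))

partialSum-monoʳ-≤ : ∀ (f : ℕ → ℚ) → (∀ i → 0ℚ ≤ f i) → ∀ {M M′} → M ℕ.≤ M′ → partialSum f M ≤ partialSum f M′
partialSum-monoʳ-≤ f 0≤f {M} {M′} M≤M′ = begin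
  partialSum f M                                                  ≤⟨ p≤p+q (partialSum-nonNeg _ (M′ ∸ M) (λ i → 0≤f (M ℕ.+ i))) ⟩
  partialSum f M + partialSum (λ i → f (M ℕ.+ i)) (M′ ∸ M)        ≡⟨ partialSum-split f M (M′ ∸ M) ⟨
  partialSum f (M ℕ.+ (M′ ∸ M))                                   ≡⟨ cong (partialSum f) (ℕₚ.m+[n∸m]≡n M≤M′) ⟩
  partialSum f M′                                                 ∎
  where open ≤-Reasoning

partialSum≤M*bound : ∀ (f : ℕ → ℚ) c M → (∀ i → i ℕ.< M → f i ≤ c) → partialSum f M ≤ ℕ→ℚ M * c
partialSum≤M*bound f c zero    f≤c = ≤-reflexive (sym (*-zeroˡ c))
partialSum≤M*bound f c (suc M) f≤c = begin
  partialSum f M + f M     ≤⟨ +-mono-≤ (partialSum≤M*bound f c M (λ i i<M → f≤c i (ℕₚ.m<n⇒m<1+n i<M))) (f≤c M (ℕₚ.n<1+n M)) ⟩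
  ℕ→ℚ M * c + c            ≡⟨ ring (ℕ→ℚ M) c ⟩
  (1ℚ + ℕ→ℚ M) * c         ≡⟨ cong (_* c) (ℕ→ℚ-suc M) ⟨
  ℕ→ℚ (suc M) * c          ∎
  where
  open ≤-Reasoning
  ring : ∀ m c → m * c + c ≡ (1ℚ + m) * c
  ring = solve-∀ ℚ-ring

sumℚ-++ : ∀ xs ys → sumℚ (xs ++ ys) ≡ sumℚ xs + sumℚ ys
sumℚ-++ []       ys = sym (+-identityˡ (sumℚ ys))
sumℚ-++ (x ∷ xs) ys = trans (cong (x +_) (sumℚ-++ xs ys)) (sym (+-assoc x (sumℚ xs) (sumℚ ys)))

sumℚ-map-concatMap : ∀ {A B : Set} (f : B → ℚ) (g : A → List B) xs →
  sumℚ (map f (concatMap g xs)) ≡ sumℚ (map (λ x → sumℚ (map f (g x))) xs)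
sumℚ-map-concatMap f g []       = refl
sumℚ-map-concatMap f g (x ∷ xs) = begin
  sumℚ (map f (g x ++ concatMap g xs))                  ≡⟨ cong sumℚ (List.map-++ f (g x) (concatMap g xs)) ⟩
  sumℚ (map f (g x) ++ map f (concatMap g xs))          ≡⟨ sumℚ-++ (map f (g x)) (map f (concatMap g xs)) ⟩
  sumℚ (map f (g x)) + sumℚ (map f (concatMap g xs))    ≡⟨ cong (sumℚ (map f (g x)) +_) (sumℚ-map-concatMap f g xs) ⟩
  sumℚ (map f (g x)) + sumℚ (map (λ x → sumℚ (map f (g x))) xs) ∎
  where open ≡-Reasoning

sumℚ-map-*ˡ : ∀ {A : Set} c (f : A → ℚ) xs → sumℚ (map (λ x → c * f x) xs) ≡ c * sumℚ (map f xs)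
sumℚ-map-*ˡ c f []       = sym (*-zeroʳ c)
sumℚ-map-*ˡ c f (x ∷ xs) =
  trans (cong (c * f x +_) (sumℚ-map-*ˡ c f xs)) (sym (*-distribˡ-+ c (f x) (sumℚ (map f xs))))

sumℚ-map-oneTo : ∀ (g : ℕ → ℚ) m → sumℚ (map g (oneTo m)) + g 0 ≡ partialSum g (suc m)
sumℚ-map-oneTo g zero    = refl
sumℚ-map-oneTo g (suc m) = begin
  sumℚ (map g (oneTo m ++ suc m ∷ [])) + g 0             ≡⟨ cong (λ xs → sumℚ xs + g 0) (List.map-++ g (oneTo m) (suc m ∷ [])) ⟩
  sumℚ (map g (oneTo m) ++ g (suc m) ∷ []) + g 0         ≡⟨ cong (_+ g 0) (sumℚ-++ (map g (oneTo m)) (g (suc m) ∷ [])) ⟩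
  (sumℚ (map g (oneTo m)) + (g (suc m) + 0ℚ)) + g 0      ≡⟨ ring (sumℚ (map g (oneTo m))) (g (suc m)) (g 0) ⟩
  (sumℚ (map g (oneTo m)) + g 0) + g (suc m)             ≡⟨ cong (_+ g (suc m)) (sumℚ-map-oneTo g m) ⟩
  partialSum g (suc m) + g (suc m)                       ∎
  where
  open ≡-Reasoning
  ring : ∀ a b c → (a + (b + 0ℚ)) + c ≡ (a + c) + b
  ring = solve-∀ ℚ-ring

-- Sequences ℕ → ℚ are coefficient sequences of power series A(x): cumsum a is A(x)/(1-x),
-- a ⋆ b is A(x)B(x), and deriv a is A'(x).

cumsum : (ℕ → ℚ) → ℕ → ℚ
cumsum a k = partialSum a (suc k)

cumsum^ : ℕ → (ℕ → ℚ) → ℕ → ℚ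
cumsum^ zero    a = a
cumsum^ (suc i) a = cumsum (cumsum^ i a)

infixl 7 _⋆_
_⋆_ : (ℕ → ℚ) → (ℕ → ℚ) → ℕ → ℚ
(a ⋆ b) k = partialSum (λ j → a j * b (k ∸ j)) (suc k)

deriv : (ℕ → ℚ) → ℕ → ℚ
deriv a k = ℕ→ℚ (suc k) * a (suc k)

infixr 8 _·_
_·_ : ℚ → (ℕ → ℚ) → ℕ → ℚ
(c · a) k = c * a k

cumsum-cong : ∀ {a b} → a ≗ b → cumsum a ≗ cumsum b
cumsum-cong a≗b k = partialSum-cong (suc k) (λ i _ → a≗b i)

cumsum-· : ∀ c a → cumsum (c · a) ≗ c · cumsum a
cumsum-· c a k = partialSum-*ˡ c a (suc k)

cumsum^-cong : ∀ i {a b} → a ≗ b → cumsum^ i a ≗ cumsum^ i b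
cumsum^-cong zero    a≗b = a≗b
cumsum^-cong (suc i) a≗b = cumsum-cong (cumsum^-cong i a≗b)

cumsum^-· : ∀ i c a → cumsum^ i (c · a) ≗ c · cumsum^ i a
cumsum^-· zero    c a k = refl
cumsum^-· (suc i) c a k = trans (cumsum-cong (cumsum^-· i c a) k) (cumsum-· c (cumsum^ i a) k)

⋆-congˡ : ∀ {a a′} b → a ≗ a′ → a ⋆ b ≗ a′ ⋆ b
⋆-congˡ b a≗a′ k = partialSum-cong (suc k) (λ j _ → cong (_* b (k ∸ j)) (a≗a′ j))

⋆-congʳ : ∀ a {b b′} → b ≗ b′ → a ⋆ b ≗ a ⋆ b′
⋆-congʳ a b≗b′ k = partialSum-cong (suc k) (λ j _ → cong (a j *_) (b≗b′ (k ∸ j)))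

⋆-comm : ∀ a b → a ⋆ b ≗ b ⋆ a
⋆-comm a b k = trans (partialSum-reverse (λ j → a j * b (k ∸ j)) k) (partialSum-cong (suc k) swap)
  where swap : ∀ j → j ℕ.< suc k → a (k ∸ j) * b (k ∸ (k ∸ j)) ≡ b j * a (k ∸ j)
        swap j j<1+k = trans (cong (λ i → a (k ∸ j) * b i) (ℕₚ.m∸[m∸n]≡n (ℕₚ.≤-pred j<1+k))) (*-comm (a (k ∸ j)) (b j))

⋆-·ʳ : ∀ a c b → a ⋆ (c · b) ≗ c · (a ⋆ b)
⋆-·ʳ a c b k = trans (partialSum-cong (suc k) (λ j _ → ring (a j) c (b (k ∸ j))))
                     (partialSum-*ˡ c (λ j → a j * b (k ∸ j)) (suc k))
  where ring : ∀ x c y → x * (c * y) ≡ c * (x * y)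
        ring = solve-∀ ℚ-ring

⋆-const1ˡ : ∀ b → (λ _ → 1ℚ) ⋆ b ≗ cumsum b
⋆-const1ˡ b k = begin
  partialSum (λ j → 1ℚ * b (k ∸ j)) (suc k)   ≡⟨ partialSum-cong (suc k) (λ j _ → *-identityˡ (b (k ∸ j))) ⟩
  partialSum (λ j → b (k ∸ j)) (suc k)        ≡⟨ partialSum-reverse b k ⟨
  partialSum b (suc k)                        ∎
  where open ≡-Reasoning

1+k∸j≡1+[k∸j] : ∀ k j → j ℕ.< suc k → suc k ∸ j ≡ suc (k ∸ j)
1+k∸j≡1+[k∸j] k j j<1+k = ℕₚ.+-∸-assoc 1 (ℕₚ.≤-pred j<1+k)

⋆-suc : ∀ a b k → (a ⋆ b) (suc k) ≡ partialSum (λ j → a j * b (suc k ∸ j)) (suc k) + a (suc k) * b 0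
⋆-suc a b k = cong (λ i → partialSum (λ j → a j * b (suc k ∸ j)) (suc k) + a (suc k) * b i) (ℕₚ.n∸n≡0 k)

⋆-cumsum : ∀ a b → a ⋆ cumsum b ≗ cumsum (a ⋆ b)
⋆-cumsum a b zero = cong (0ℚ +_) (trans (cong (a 0 *_) (+-identityˡ (b 0))) (sym (+-identityˡ (a 0 * b 0))))
⋆-cumsum a b (suc k) = begin
  (a ⋆ cumsum b) (suc k)
    ≡⟨ ⋆-suc a (cumsum b) k ⟩
  partialSum (λ j → a j * cumsum b (suc k ∸ j)) (suc k) + a (suc k) * (0ℚ + b 0)
    ≡⟨ cong₂ _+_ (partialSum-cong (suc k) split) (cong (a (suc k) *_) (+-identityˡ (b 0))) ⟩
  partialSum (λ j → a j * cumsum b (k ∸ j) + a j * b (suc k ∸ j)) (suc k) + a (suc k) * b 0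
    ≡⟨ cong (_+ a (suc k) * b 0) (partialSum-+ (λ j → a j * cumsum b (k ∸ j)) (λ j → a j * b (suc k ∸ j)) (suc k)) ⟩
  ((a ⋆ cumsum b) k + partialSum (λ j → a j * b (suc k ∸ j)) (suc k)) + a (suc k) * b 0
    ≡⟨ +-assoc ((a ⋆ cumsum b) k) _ (a (suc k) * b 0) ⟩
  (a ⋆ cumsum b) k + (partialSum (λ j → a j * b (suc k ∸ j)) (suc k) + a (suc k) * b 0)
    ≡⟨ cong₂ _+_ (⋆-cumsum a b k) (sym (⋆-suc a b k)) ⟩
  cumsum (a ⋆ b) (suc k) ∎
  where
  open ≡-Reasoning
  split : ∀ j → j ℕ.< suc k → a j * cumsum b (suc k ∸ j) ≡ a j * cumsum b (k ∸ j) + a j * b (suc k ∸ j)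
  split j j<1+k rewrite 1+k∸j≡1+[k∸j] k j j<1+k = *-distribˡ-+ (a j) (cumsum b (k ∸ j)) (b (suc (k ∸ j)))

⋆-cumsum^ : ∀ i a b → a ⋆ cumsum^ i b ≗ cumsum^ i (a ⋆ b)
⋆-cumsum^ zero    a b k = refl
⋆-cumsum^ (suc i) a b k = trans (⋆-cumsum a (cumsum^ i b) k) (cumsum-cong (⋆-cumsum^ i a b) k)

deriv-· : ∀ c a → deriv (c · a) ≗ c · deriv a
deriv-· c a k = ring (ℕ→ℚ (suc k)) c (a (suc k))
  where ring : ∀ n c y → n * (c * y) ≡ c * (n * y)
        ring = solve-∀ ℚ-ring

deriv-injective : ∀ a b → a 0 ≡ b 0 → deriv a ≗ deriv b → a ≗ b
deriv-injective a b a₀≡b₀ a′≗b′ zero    = a₀≡b₀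
deriv-injective a b a₀≡b₀ a′≗b′ (suc k) = begin
  a (suc k)                                       ≡⟨ cancel a ⟨
  inv (suc k) * (ℕ→ℚ (suc k) * a (suc k))         ≡⟨ cong (inv (suc k) *_) (a′≗b′ k) ⟩
  inv (suc k) * (ℕ→ℚ (suc k) * b (suc k))         ≡⟨ cancel b ⟩
  b (suc k)                                       ∎
  where
  open ≡-Reasoning
  cancel : ∀ c → inv (suc k) * (ℕ→ℚ (suc k) * c (suc k)) ≡ c (suc k)
  cancel c = begin
    inv (suc k) * (ℕ→ℚ (suc k) * c (suc k))   ≡⟨ *-assoc (inv (suc k)) (ℕ→ℚ (suc k)) (c (suc k)) ⟨
    (inv (suc k) * ℕ→ℚ (suc k)) * c (suc k)   ≡⟨ cong (_* c (suc k)) (trans (*-comm (inv (suc k)) (ℕ→ℚ (suc k))) (ℕ→ℚ*inv≡1 k)) ⟩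
    1ℚ * c (suc k)                            ≡⟨ *-identityˡ (c (suc k)) ⟩
    c (suc k)                                 ∎

-- The Leibniz rule (AB)′ = A′B + AB′: split the weight k+1 of a_j b_{k+1-j} as j + (k+1-j).
deriv-⋆ : ∀ a b → deriv (a ⋆ b) ≗ λ k → (deriv a ⋆ b) k + (a ⋆ deriv b) k
deriv-⋆ a b k = begin
  K * partialSum (λ j → a j * b (suc k ∸ j)) (2+k)
    ≡⟨ partialSum-*ˡ K (λ j → a j * b (suc k ∸ j)) (2+k) ⟨
  partialSum (λ j → K * (a j * b (suc k ∸ j))) (2+k)
    ≡⟨ partialSum-cong (2+k) split ⟩
  partialSum (λ j → left j + right j) (2+k)
    ≡⟨ partialSum-+ left right (2+k) ⟩
  partialSum left (2+k) + partialSum right (2+k)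
    ≡⟨ cong₂ _+_ (partialSum-suc left (suc k)) (cong (partialSum right (suc k) +_) right-last) ⟩
  (left 0 + partialSum (left ∘ suc) (suc k)) + (partialSum right (suc k) + 0ℚ)
    ≡⟨ cong₂ _+_ (trans (cong (_+ partialSum (left ∘ suc) (suc k)) (*-zeroˡ (a 0 * b (suc k)))) (+-identityˡ (partialSum (left ∘ suc) (suc k))))
                 (+-identityʳ (partialSum right (suc k))) ⟩
  partialSum (left ∘ suc) (suc k) + partialSum right (suc k)
    ≡⟨ cong₂ _+_ (partialSum-cong (suc k) (λ j _ → sym (*-assoc (ℕ→ℚ (suc j)) (a (suc j)) (b (k ∸ j)))))
                 (partialSum-cong (suc k) (λ j j<1+k → cong (λ i → a j * (ℕ→ℚ i * b i)) (1+k∸j≡1+[k∸j] k j j<1+k))) ⟩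
  (deriv a ⋆ b) k + (a ⋆ deriv b) k
    ∎
  where
  open ≡-Reasoning
  2+k = suc (suc k)
  K = ℕ→ℚ (suc k)
  left right : ℕ → ℚ
  left j = ℕ→ℚ j * (a j * b (suc k ∸ j))
  right j = a j * (ℕ→ℚ (suc k ∸ j) * b (suc k ∸ j))
  split : ∀ j → j ℕ.< 2+k → K * (a j * b (suc k ∸ j)) ≡ left j + right j
  split j j<2+k = begin
    K * (a j * b (suc k ∸ j))                          ≡⟨ cong (λ i → ℕ→ℚ i * (a j * b (suc k ∸ j))) (ℕₚ.m+[n∸m]≡n (ℕₚ.≤-pred j<2+k)) ⟨
    ℕ→ℚ (j ℕ.+ (suc k ∸ j)) * (a j * b (suc k ∸ j))   ≡⟨ cong (_* (a j * b (suc k ∸ j))) (ℕ→ℚ-+ j (suc k ∸ j)) ⟩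
    (ℕ→ℚ j + ℕ→ℚ (suc k ∸ j)) * (a j * b (suc k ∸ j)) ≡⟨ ring (ℕ→ℚ j) (ℕ→ℚ (suc k ∸ j)) (a j) (b (suc k ∸ j)) ⟩
    left j + right j                                   ∎
    where ring : ∀ x y p q → (x + y) * (p * q) ≡ x * (p * q) + p * (y * q)
          ring = solve-∀ ℚ-ring
  right-last : right (suc k) ≡ 0ℚ
  right-last = begin
    a (suc k) * (ℕ→ℚ (k ∸ k) * b (k ∸ k))   ≡⟨ cong (λ i → a (suc k) * (ℕ→ℚ i * b i)) (ℕₚ.n∸n≡0 k) ⟩
    a (suc k) * (0ℚ * b 0)                  ≡⟨ cong (a (suc k) *_) (*-zeroˡ (b 0)) ⟩
    a (suc k) * 0ℚ                          ≡⟨ *-zeroʳ (a (suc k)) ⟩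
    0ℚ                                      ∎

stirling1-< : ∀ {k p} → k ℕ.< p → stirling1 k p ≡ 0
stirling1-< {zero}  {suc p} _       = refl
stirling1-< {suc k} {suc p} 1+k<1+p =
  cong₂ ℕ._+_ (trans (cong (k ℕ.*_) (stirling1-< (ℕₚ.m<n⇒m<1+n k<p))) (ℕₚ.*-zeroʳ k)) (stirling1-< k<p)
  where k<p = ℕₚ.≤-pred 1+k<1+p

-- [k p]/k! is the k-th coefficient of L(x)^p/p!, where L(x) = -log(1-x) = Σ x^k/k.
stirlingEGF : ℕ → ℕ → ℚ
stirlingEGF p k = ℕ→ℚ (stirling1 k p) * inv (k !)

stirlingEGF-< : ∀ {k p} → k ℕ.< p → stirlingEGF p k ≡ 0ℚ
stirlingEGF-< {k} k<p = trans (cong (λ s → ℕ→ℚ s * inv (k !)) (stirling1-< k<p)) (*-zeroˡ (inv (k !)))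

stirlingEGF-rec : ∀ p k →
  ℕ→ℚ (suc k) * stirlingEGF (suc p) (suc k) ≡ ℕ→ℚ k * stirlingEGF (suc p) k + stirlingEGF p k
stirlingEGF-rec p k = begin
  K * (N * inv (suc k ℕ.* k !))              ≡⟨ cong (λ m → K * (N * inv m)) (ℕₚ.*-comm (suc k) (k !)) ⟩
  K * (N * inv (k ! ℕ.* suc k))              ≡⟨ ring₁ K N (inv (k ! ℕ.* suc k)) ⟩
  N * (K * inv (k ! ℕ.* suc k))              ≡⟨ cong (N *_) (ℕ→ℚ[1+t]*inv[a*[1+t]]≡inv[a] (k !) k) ⟩
  N * inv (k !)                              ≡⟨ cong (_* inv (k !)) (trans (ℕ→ℚ-+ (k ℕ.* s) s′) (cong (_+ ℕ→ℚ s′) (ℕ→ℚ-* k s))) ⟩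
  (ℕ→ℚ k * ℕ→ℚ s + ℕ→ℚ s′) * inv (k !)      ≡⟨ ring₂ (ℕ→ℚ k) (ℕ→ℚ s) (ℕ→ℚ s′) (inv (k !)) ⟩
  ℕ→ℚ k * (ℕ→ℚ s * inv (k !)) + ℕ→ℚ s′ * inv (k !) ∎
  where
  open ≡-Reasoning
  K = ℕ→ℚ (suc k)
  s = stirling1 k (suc p)
  s′ = stirling1 k p
  N = ℕ→ℚ (k ℕ.* s ℕ.+ s′)
  ring₁ : ∀ x y z → x * (y * z) ≡ y * (x * z)
  ring₁ = solve-∀ ℚ-ring
  ring₂ : ∀ x y z i → (x * y + z) * i ≡ x * (y * i) + z * i
  ring₂ = solve-∀ ℚ-ring

deriv-stirlingEGF : ∀ p → deriv (stirlingEGF (suc p)) ≗ cumsum (stirlingEGF p)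
deriv-stirlingEGF p zero    = trans (stirlingEGF-rec p 0) (cong (_+ stirlingEGF p 0) (*-zeroˡ (stirlingEGF (suc p) 0)))
deriv-stirlingEGF p (suc k) = trans (stirlingEGF-rec p (suc k)) (cong (_+ stirlingEGF p (suc k)) (deriv-stirlingEGF p k))

deriv-stirlingEGF-0 : deriv (stirlingEGF 0) ≗ λ _ → 0ℚ
deriv-stirlingEGF-0 k = trans (cong (ℕ→ℚ (suc k) *_) (*-zeroˡ (inv (suc k !)))) (*-zeroʳ (ℕ→ℚ (suc k)))

deriv-inv : deriv inv ≗ λ _ → 1ℚ
deriv-inv = ℕ→ℚ*inv≡1

⋆-const0ʳ : ∀ a → a ⋆ (λ _ → 0ℚ) ≗ λ _ → 0ℚ
⋆-const0ʳ a k = partialSum-≡0 (λ j → a j * 0ℚ) (suc k) (λ j _ → *-zeroʳ (a j))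

-- L(x) · L(x)^p/p! = (p+1) · L(x)^(p+1)/(p+1)!, compared through derivatives, using L′(x) = 1/(1-x).
inv⋆stirlingEGF : ∀ p → inv ⋆ stirlingEGF p ≗ ℕ→ℚ (suc p) · stirlingEGF (suc p)
inv⋆deriv-stirlingEGF : ∀ p → inv ⋆ deriv (stirlingEGF p) ≗ ℕ→ℚ p · cumsum (stirlingEGF p)

inv⋆stirlingEGF p = deriv-injective _ _ at-0 λ k → begin
  deriv (inv ⋆ u p) k                                ≡⟨ deriv-⋆ inv (u p) k ⟩
  (deriv inv ⋆ u p) k + (inv ⋆ deriv (u p)) k        ≡⟨ cong₂ _+_ (trans (⋆-congˡ (u p) deriv-inv k) (⋆-const1ˡ (u p) k))
                                                                  (inv⋆deriv-stirlingEGF p k) ⟩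
  cumsum (u p) k + ℕ→ℚ p * cumsum (u p) k            ≡⟨ ring (ℕ→ℚ p) (cumsum (u p) k) ⟩
  (1ℚ + ℕ→ℚ p) * cumsum (u p) k                      ≡⟨ cong₂ _*_ (ℕ→ℚ-suc p) (deriv-stirlingEGF p k) ⟨
  ℕ→ℚ (suc p) * deriv (u (suc p)) k                  ≡⟨ deriv-· (ℕ→ℚ (suc p)) (u (suc p)) k ⟨
  deriv (ℕ→ℚ (suc p) · u (suc p)) k                  ∎
  where
  open ≡-Reasoning
  u = stirlingEGF
  at-0 : (inv ⋆ u p) 0 ≡ ℕ→ℚ (suc p) * u (suc p) 0
  at-0 = begin
    0ℚ + 0ℚ * u p 0              ≡⟨ trans (+-identityˡ (0ℚ * u p 0)) (*-zeroˡ (u p 0)) ⟩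
    0ℚ                           ≡⟨ *-zeroʳ (ℕ→ℚ (suc p)) ⟨
    ℕ→ℚ (suc p) * 0ℚ             ≡⟨ cong (ℕ→ℚ (suc p) *_) (*-zeroˡ (inv 1)) ⟨
    ℕ→ℚ (suc p) * u (suc p) 0    ∎
  ring : ∀ n s → s + n * s ≡ (1ℚ + n) * s
  ring = solve-∀ ℚ-ring

inv⋆deriv-stirlingEGF zero k = begin
  (inv ⋆ deriv (stirlingEGF 0)) k         ≡⟨ ⋆-congʳ inv deriv-stirlingEGF-0 k ⟩
  (inv ⋆ (λ _ → 0ℚ)) k                    ≡⟨ ⋆-const0ʳ inv k ⟩
  0ℚ                                      ≡⟨ *-zeroˡ (cumsum (stirlingEGF 0) k) ⟨
  0ℚ * cumsum (stirlingEGF 0) k           ∎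
  where open ≡-Reasoning
inv⋆deriv-stirlingEGF (suc p) k = begin
  (inv ⋆ deriv (stirlingEGF (suc p))) k                ≡⟨ ⋆-congʳ inv (deriv-stirlingEGF p) k ⟩
  (inv ⋆ cumsum (stirlingEGF p)) k                     ≡⟨ ⋆-cumsum inv (stirlingEGF p) k ⟩
  cumsum (inv ⋆ stirlingEGF p) k                       ≡⟨ cumsum-cong (inv⋆stirlingEGF p) k ⟩
  cumsum (ℕ→ℚ (suc p) · stirlingEGF (suc p)) k        ≡⟨ cumsum-· (ℕ→ℚ (suc p)) (stirlingEGF (suc p)) k ⟩
  ℕ→ℚ (suc p) * cumsum (stirlingEGF (suc p)) k        ∎
  where open ≡-Reasoning

H≗cumsum-inv : H ≗ cumsum inv
H≗cumsum-inv zero    = refl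
H≗cumsum-inv (suc k) = cong (_+ inv (suc k)) (H≗cumsum-inv k)

W-zero : W 0 ≗ stirlingEGF 0
W-zero zero    = refl
W-zero (suc k) = sym (*-zeroˡ (inv (suc k !)))

W-suc : ∀ p → W (suc p) ≗ H ⋆ W p
W-suc p k = begin
  sumℚ (map prodH (concatMap (λ j → map (j ∷_) (compositions p (k ∸ j))) (oneTo k)))
    ≡⟨ sumℚ-map-concatMap prodH (λ j → map (j ∷_) (compositions p (k ∸ j))) (oneTo k) ⟩
  sumℚ (map (λ j → sumℚ (map prodH (map (j ∷_) (compositions p (k ∸ j))))) (oneTo k))
    ≡⟨ cong sumℚ (List.map-cong first-part (oneTo k)) ⟩
  sumℚ (map term (oneTo k))
    ≡⟨ +-identityʳ (sumℚ (map term (oneTo k))) ⟨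
  sumℚ (map term (oneTo k)) + 0ℚ
    ≡⟨ cong (sumℚ (map term (oneTo k)) +_) (*-zeroˡ (W p k)) ⟨
  sumℚ (map term (oneTo k)) + term 0
    ≡⟨ sumℚ-map-oneTo term k ⟩
  (H ⋆ W p) k ∎
  where
  open ≡-Reasoning
  prodH = λ c → prodℚ (map H c)
  term = λ j → H j * W p (k ∸ j)
  first-part : ∀ j → sumℚ (map prodH (map (j ∷_) (compositions p (k ∸ j)))) ≡ term j
  first-part j = trans (cong sumℚ (sym (List.map-∘ (compositions p (k ∸ j)))))
                       (sumℚ-map-*ˡ (H j) prodH (compositions p (k ∸ j)))

W≗p!·cumsum^p-stirlingEGF : ∀ p → W p ≗ ℕ→ℚ (p !) · cumsum^ p (stirlingEGF p)
W≗p!·cumsum^p-stirlingEGF zero    k = trans (W-zero k) (sym (*-identityˡ (stirlingEGF 0 k)))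
W≗p!·cumsum^p-stirlingEGF (suc p) k = begin
  W (suc p) k                      ≡⟨ W-suc p k ⟩
  (H ⋆ W p) k                      ≡⟨ ⋆-congʳ H (W≗p!·cumsum^p-stirlingEGF p) k ⟩
  (H ⋆ X) k                        ≡⟨ ⋆-congˡ X H≗cumsum-inv k ⟩
  (cumsum inv ⋆ X) k               ≡⟨ ⋆-comm (cumsum inv) X k ⟩
  (X ⋆ cumsum inv) k               ≡⟨ ⋆-cumsum X inv k ⟩
  cumsum (X ⋆ inv) k               ≡⟨ cumsum-cong (λ j → trans (⋆-comm X inv j) (inv⋆X j)) k ⟩
  cumsum (ℕ→ℚ (suc p !) · cumsum^ p (u (suc p))) k ≡⟨ cumsum-· (ℕ→ℚ (suc p !)) (cumsum^ p (u (suc p))) k ⟩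
  ℕ→ℚ (suc p !) * cumsum^ (suc p) (u (suc p)) k    ∎
  where
  open ≡-Reasoning
  u = stirlingEGF
  X = ℕ→ℚ (p !) · cumsum^ p (u p)
  p!*[1+p]≡[1+p]! : ℕ→ℚ (p !) * ℕ→ℚ (suc p) ≡ ℕ→ℚ (suc p !)
  p!*[1+p]≡[1+p]! = trans (*-comm (ℕ→ℚ (p !)) (ℕ→ℚ (suc p))) (sym (ℕ→ℚ-* (suc p) (p !)))
  inv⋆X : inv ⋆ X ≗ ℕ→ℚ (suc p !) · cumsum^ p (u (suc p))
  inv⋆X j = begin
    (inv ⋆ X) j                                                ≡⟨ ⋆-·ʳ inv (ℕ→ℚ (p !)) (cumsum^ p (u p)) j ⟩
    ℕ→ℚ (p !) * (inv ⋆ cumsum^ p (u p)) j                      ≡⟨ cong (ℕ→ℚ (p !) *_) (⋆-cumsum^ p inv (u p) j) ⟩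
    ℕ→ℚ (p !) * cumsum^ p (inv ⋆ u p) j                        ≡⟨ cong (ℕ→ℚ (p !) *_) (cumsum^-cong p (inv⋆stirlingEGF p) j) ⟩
    ℕ→ℚ (p !) * cumsum^ p (ℕ→ℚ (suc p) · u (suc p)) j          ≡⟨ cong (ℕ→ℚ (p !) *_) (cumsum^-· p (ℕ→ℚ (suc p)) (u (suc p)) j) ⟩
    ℕ→ℚ (p !) * (ℕ→ℚ (suc p) * cumsum^ p (u (suc p)) j)        ≡⟨ *-assoc (ℕ→ℚ (p !)) (ℕ→ℚ (suc p)) (cumsum^ p (u (suc p)) j) ⟨
    (ℕ→ℚ (p !) * ℕ→ℚ (suc p)) * cumsum^ p (u (suc p)) j        ≡⟨ cong (_* cumsum^ p (u (suc p)) j) p!*[1+p]≡[1+p]! ⟩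
    ℕ→ℚ (suc p !) * cumsum^ p (u (suc p)) j                    ∎

risingProd-suc : ∀ k m → risingProd k (suc m) ≡ risingProd (suc k) m ℕ.* k
risingProd-suc k zero    = trans (cong (k ℕ.*_) (ℕₚ.+-comm k 1)) (ℕₚ.*-comm k (suc k))
risingProd-suc k (suc m) = begin
  risingProd k (suc m) ℕ.* (k ℕ.+ suc (suc m))          ≡⟨ cong₂ ℕ._*_ (risingProd-suc k m) (ℕₚ.+-suc k (suc m)) ⟩
  risingProd (suc k) m ℕ.* k ℕ.* (suc k ℕ.+ suc m)      ≡⟨ ℕₚ.*-assoc (risingProd (suc k) m) k (suc k ℕ.+ suc m) ⟩
  risingProd (suc k) m ℕ.* (k ℕ.* (suc k ℕ.+ suc m))    ≡⟨ cong (risingProd (suc k) m ℕ.*_) (ℕₚ.*-comm k (suc k ℕ.+ suc m)) ⟩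
  risingProd (suc k) m ℕ.* ((suc k ℕ.+ suc m) ℕ.* k)    ≡⟨ ℕₚ.*-assoc (risingProd (suc k) m) (suc k ℕ.+ suc m) k ⟨
  risingProd (suc k) (suc m) ℕ.* k                      ∎
  where open ≡-Reasoning

inv-risingProd-telescope : ∀ k m →
  inv (risingProd (suc k) m) ≡ inv (risingProd (suc (suc k)) m) + ℕ→ℚ (suc m) * inv (risingProd (suc k) (suc m))
inv-risingProd-telescope k m = begin
  inv (R K m)                                             ≡⟨ ℕ→ℚ[1+t]*inv[a*[1+t]]≡inv[a] (R K m) (k ℕ.+ suc m) ⟨
  ℕ→ℚ (K ℕ.+ suc m) * inv (R K (suc m))                   ≡⟨ cong (_* inv (R K (suc m))) (ℕ→ℚ-+ K (suc m)) ⟩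
  (ℕ→ℚ K + ℕ→ℚ (suc m)) * inv (R K (suc m))               ≡⟨ *-distribʳ-+ (inv (R K (suc m))) (ℕ→ℚ K) (ℕ→ℚ (suc m)) ⟩
  ℕ→ℚ K * inv (R K (suc m)) + ℕ→ℚ (suc m) * inv (R K (suc m))
    ≡⟨ cong (_+ ℕ→ℚ (suc m) * inv (R K (suc m))) (trans (cong (λ r → ℕ→ℚ K * inv r) (risingProd-suc K m))
                                                         (ℕ→ℚ[1+t]*inv[a*[1+t]]≡inv[a] (R (suc K) m) k)) ⟩
  inv (R (suc K) m) + ℕ→ℚ (suc m) * inv (R K (suc m))     ∎
  where
  open ≡-Reasoning
  R = risingProd
  K = suc k

risingSum : ℕ → (ℕ → ℚ) → ℕ → ℚ
risingSum m a K = partialSum (λ k → a k * inv (risingProd k m)) K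

summation-by-parts : ∀ (b : ℕ → ℚ) → b 0 ≡ 0ℚ → ∀ m K →
  ℕ→ℚ (suc m) * risingSum (suc m) (cumsum b) K + partialSum b K * inv (risingProd K m) ≡ risingSum m b K
summation-by-parts b b₀≡0 m zero =
  trans (cong₂ _+_ (*-zeroʳ (ℕ→ℚ (suc m))) (*-zeroˡ (inv (risingProd 0 m)))) (+-identityˡ 0ℚ)
summation-by-parts b b₀≡0 m (suc K) = begin
  c * (T K + X * r₁) + X * r₂          ≡⟨ ring₁ c (T K) X r₁ r₂ ⟩
  c * T K + X * (c * r₁ + r₂)          ≡⟨ cong (c * T K +_) (boundary K) ⟩
  c * T K + (P + b K) * r₀             ≡⟨ ring₂ (c * T K) P (b K) r₀ ⟩
  (c * T K + P * r₀) + b K * r₀        ≡⟨ cong (_+ b K * r₀) (summation-by-parts b b₀≡0 m K) ⟩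
  risingSum m b K + b K * r₀           ∎
  where
  open ≡-Reasoning
  R = risingProd
  c = ℕ→ℚ (suc m)
  T = risingSum (suc m) (cumsum b)
  X = partialSum b (suc K)
  P = partialSum b K
  r₀ = inv (R K m)
  r₁ = inv (R K (suc m))
  r₂ = inv (R (suc K) m)
  boundary : ∀ K → partialSum b (suc K) * (c * inv (R K (suc m)) + inv (R (suc K) m)) ≡ partialSum b (suc K) * inv (R K m)
  boundary zero    = begin
    partialSum b 1 * s     ≡⟨ cong (_* s) b₀₁≡0 ⟩
    0ℚ * s                 ≡⟨ *-zeroˡ s ⟩
    0ℚ                     ≡⟨ *-zeroˡ (inv (R 0 m)) ⟨
    0ℚ * inv (R 0 m)       ≡⟨ cong (_* inv (R 0 m)) b₀₁≡0 ⟨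
    partialSum b 1 * inv (R 0 m) ∎
    where
    s = c * inv (R 0 (suc m)) + inv (R 1 m)
    b₀₁≡0 : partialSum b 1 ≡ 0ℚ
    b₀₁≡0 = trans (+-identityˡ (b 0)) b₀≡0
  boundary (suc K) = cong (partialSum b (2+ K) *_) (trans (+-comm (c * inv (R (suc K) (suc m))) (inv (R (2+ K) m)))
                                                        (sym (inv-risingProd-telescope K m)))
    where 2+ = λ k → suc (suc k)
  ring₁ : ∀ c t x r₁ r₂ → c * (t + x * r₁) + x * r₂ ≡ c * t + x * (c * r₁ + r₂)
  ring₁ = solve-∀ ℚ-ring
  ring₂ : ∀ a p b r → a + (p + b) * r ≡ (a + p * r) + b * r
  ring₂ = solve-∀ ℚ-ring

risingFactorial : ℕ → ℕ → ℕ
risingFactorial m zero    = 1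
risingFactorial m (suc j) = risingFactorial m j ℕ.* suc (j ℕ.+ m)

boundaryTerm : (ℕ → ℚ) → ℕ → ℕ → ℕ → ℚ
boundaryTerm a m j K = partialSum (cumsum^ j a) K * inv (risingProd K (j ℕ.+ m))

boundaryTerms : (ℕ → ℚ) → ℕ → ℕ → ℕ → ℚ
boundaryTerms a m zero    K = 0ℚ
boundaryTerms a m (suc j) K = boundaryTerms a m j K + ℕ→ℚ (risingFactorial m j) * boundaryTerm a m j K

cumsum^-at-0 : ∀ j a → a 0 ≡ 0ℚ → cumsum^ j a 0 ≡ 0ℚ
cumsum^-at-0 zero    a a₀≡0 = a₀≡0
cumsum^-at-0 (suc j) a a₀≡0 = trans (+-identityˡ (cumsum^ j a 0)) (cumsum^-at-0 j a a₀≡0)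

summation-by-parts^ : ∀ (a : ℕ → ℚ) → a 0 ≡ 0ℚ → ∀ m j K →
  ℕ→ℚ (risingFactorial m j) * risingSum (j ℕ.+ m) (cumsum^ j a) K + boundaryTerms a m j K ≡ risingSum m a K
summation-by-parts^ a a₀≡0 m zero    K =
  trans (+-identityʳ (1ℚ * risingSum m a K)) (*-identityˡ (risingSum m a K))
summation-by-parts^ a a₀≡0 m (suc j) K = begin
  ℕ→ℚ (F ℕ.* suc (j ℕ.+ m)) * T (suc j) + (E + ℕ→ℚ F * Y)  ≡⟨ cong (λ x → x * T (suc j) + (E + ℕ→ℚ F * Y)) (ℕ→ℚ-* F (suc (j ℕ.+ m))) ⟩
  (ℕ→ℚ F * c) * T (suc j) + (E + ℕ→ℚ F * Y)                ≡⟨ ring (ℕ→ℚ F) c (T (suc j)) E Y ⟩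
  ℕ→ℚ F * (c * T (suc j) + Y) + E                          ≡⟨ cong (λ x → ℕ→ℚ F * x + E)
                                                                   (summation-by-parts (cumsum^ j a) (cumsum^-at-0 j a a₀≡0) (j ℕ.+ m) K) ⟩
  ℕ→ℚ F * T j + E                                          ≡⟨ summation-by-parts^ a a₀≡0 m j K ⟩
  risingSum m a K                                          ∎
  where
  open ≡-Reasoning
  F = risingFactorial m j
  c = ℕ→ℚ (suc (j ℕ.+ m))
  T = λ i → risingSum (i ℕ.+ m) (cumsum^ i a) K
  E = boundaryTerms a m j K
  Y = boundaryTerm a m j K
  ring : ∀ f c t e y → (f * c) * t + (e + f * y) ≡ f * (c * t + y) + e
  ring = solve-∀ ℚ-ring

risingFactorial*m!≡[j+m]! : ∀ m j → risingFactorial m j ℕ.* m ! ≡ (j ℕ.+ m) !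
risingFactorial*m!≡[j+m]! m zero    = ℕₚ.+-identityʳ (m !)
risingFactorial*m!≡[j+m]! m (suc j) = begin
  F ℕ.* suc (j ℕ.+ m) ℕ.* m !          ≡⟨ ℕₚ.*-assoc F (suc (j ℕ.+ m)) (m !) ⟩
  F ℕ.* (suc (j ℕ.+ m) ℕ.* m !)        ≡⟨ cong (F ℕ.*_) (ℕₚ.*-comm (suc (j ℕ.+ m)) (m !)) ⟩
  F ℕ.* (m ! ℕ.* suc (j ℕ.+ m))        ≡⟨ ℕₚ.*-assoc F (m !) (suc (j ℕ.+ m)) ⟨
  F ℕ.* m ! ℕ.* suc (j ℕ.+ m)          ≡⟨ cong (ℕ._* suc (j ℕ.+ m)) (risingFactorial*m!≡[j+m]! m j) ⟩
  (j ℕ.+ m) ! ℕ.* suc (j ℕ.+ m)        ≡⟨ ℕₚ.*-comm ((j ℕ.+ m) !) (suc (j ℕ.+ m)) ⟩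
  suc (j ℕ.+ m) !                      ∎
  where
  open ≡-Reasoning
  F = risingFactorial m j

[p+m]Cp*p!≡risingFactorial : ∀ p m → ((p ℕ.+ m) C p) ℕ.* p ! ≡ risingFactorial m p
[p+m]Cp*p!≡risingFactorial p m = ℕₚ.*-cancelʳ-≡ _ _ (m !) {{m ℕₚ.!≢0}} (begin
  (n C p) ℕ.* p ! ℕ.* m !                     ≡⟨ ℕₚ.*-assoc (n C p) (p !) (m !) ⟩
  (n C p) ℕ.* (p ! ℕ.* m !)                   ≡⟨ cong (λ i → (n C p) ℕ.* (p ! ℕ.* i !)) (ℕₚ.m+n∸m≡n p m) ⟨
  (n C p) ℕ.* (p ! ℕ.* (n ∸ p) !)             ≡⟨ cong (ℕ._* (p ! ℕ.* (n ∸ p) !)) (ℕC.nCk≡n!/k![n-k]! p≤n) ⟩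
  (n ! ℕD./ (p ! ℕ.* (n ∸ p) !)) ℕ.* (p ! ℕ.* (n ∸ p) !)
                                              ≡⟨ ℕD.m/n*n≡m (ℕC.k![n∸k]!∣n! p≤n) ⟩
  n !                                         ≡⟨ risingFactorial*m!≡[j+m]! m p ⟨
  risingFactorial m p ℕ.* m !                 ∎)
  where
  open ≡-Reasoning
  n = p ℕ.+ m
  p≤n = ℕₚ.m≤m+n p m
  instance _ = p ℕₚ.!* (n ∸ p) !≢0

cumsum^-stirlingEGF-< : ∀ j {p k} → k ℕ.< p → cumsum^ j (stirlingEGF p) k ≡ 0ℚ
cumsum^-stirlingEGF-< zero    k<p = stirlingEGF-< k<p
cumsum^-stirlingEGF-< (suc j) {p} {k} k<p = partialSum-≡0 (cumsum^ j (stirlingEGF p)) (suc k)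
  (λ i i<1+k → cumsum^-stirlingEGF-< j (ℕₚ.<-≤-trans i<1+k k<p))

partialSum-lhsTerm : ∀ p n K →
  partialSum (lhsTerm p n) K ≡ ℕ→ℚ (p !) * risingSum n (cumsum^ p (stirlingEGF p)) K
partialSum-lhsTerm p n K = begin
  partialSum (λ k → W p k * inv (risingProd k n)) K                                   ≡⟨ partialSum-cong K (λ k _ → factor k) ⟩
  partialSum (λ k → ℕ→ℚ (p !) * (cumsum^ p (stirlingEGF p) k * inv (risingProd k n))) K ≡⟨ partialSum-*ˡ (ℕ→ℚ (p !)) _ K ⟩
  ℕ→ℚ (p !) * risingSum n (cumsum^ p (stirlingEGF p)) K                               ∎
  where
  open ≡-Reasoning
  factor : ∀ k → W p k * inv (risingProd k n) ≡ ℕ→ℚ (p !) * (cumsum^ p (stirlingEGF p) k * inv (risingProd k n))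
  factor k = trans (cong (_* inv (risingProd k n)) (W≗p!·cumsum^p-stirlingEGF p k))
                   (*-assoc (ℕ→ℚ (p !)) (cumsum^ p (stirlingEGF p) k) (inv (risingProd k n)))

rhsPartial≡risingSum : ∀ p m → 0 ℕ.< p → ∀ M → rhsPartial p (p ℕ.+ m) M ≡ risingSum m (stirlingEGF p) (p ℕ.+ M)
rhsPartial≡risingSum p m 0<p M = begin
  partialSum (λ i → rhsTerm p (p ℕ.+ m) (p ℕ.+ i)) M                     ≡⟨ partialSum-cong M (λ i _ → rhsTerm-shape (p ℕ.+ i)) ⟨
  partialSum (λ i → stirlingEGF p (p ℕ.+ i) * inv (risingProd (p ℕ.+ i) m)) M
    ≡⟨ partialSum-dropInitialZeros (λ k → stirlingEGF p k * inv (risingProd k m)) p M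
         (λ k k<p → trans (cong (_* inv (risingProd k m)) (stirlingEGF-< k<p)) (*-zeroˡ (inv (risingProd k m)))) ⟨
  risingSum m (stirlingEGF p) (p ℕ.+ M)                                  ∎
  where
  open ≡-Reasoning
  rhsTerm-shape : ∀ k → stirlingEGF p k * inv (risingProd k m) ≡ rhsTerm p (p ℕ.+ m) k
  rhsTerm-shape k = begin
    ℕ→ℚ (stirling1 k p) * inv (k !) * inv (risingProd k m)       ≡⟨ ring (ℕ→ℚ (stirling1 k p)) (inv (k !)) (inv (risingProd k m)) ⟩
    inv (risingProd k m) * ℕ→ℚ (stirling1 k p) * inv (k !)       ≡⟨ cong (λ i → inv (risingProd k i) * ℕ→ℚ (stirling1 k p) * inv (k !)) (ℕₚ.m+n∸m≡n p m) ⟨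
    rhsTerm p (p ℕ.+ m) k                                        ∎
    where ring : ∀ a b c → a * b * c ≡ c * a * b
          ring = solve-∀ ℚ-ring

lhsPartial+boundaryTerms≡rhsPartial : ∀ p m → 0 ℕ.< p → ∀ M →
  lhsPartial p (p ℕ.+ m) M + boundaryTerms (stirlingEGF p) m p (p ℕ.+ M) ≡ rhsPartial p (p ℕ.+ m) M
lhsPartial+boundaryTerms≡rhsPartial p m 0<p M = begin
  ℕ→ℚ binom * partialSum (λ i → lhsTerm p n (p ℕ.+ i)) M + E
    ≡⟨ cong (λ x → ℕ→ℚ binom * x + E) (partialSum-dropInitialZeros (lhsTerm p n) p M lhsTerm-<) ⟨
  ℕ→ℚ binom * partialSum (lhsTerm p n) K + E
    ≡⟨ cong (λ x → ℕ→ℚ binom * x + E) (partialSum-lhsTerm p n K) ⟩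
  ℕ→ℚ binom * (ℕ→ℚ (p !) * T) + E
    ≡⟨ cong (_+ E) (*-assoc (ℕ→ℚ binom) (ℕ→ℚ (p !)) T) ⟨
  ℕ→ℚ binom * ℕ→ℚ (p !) * T + E
    ≡⟨ cong (λ x → x * T + E) (trans (sym (ℕ→ℚ-* binom (p !))) (cong ℕ→ℚ ([p+m]Cp*p!≡risingFactorial p m))) ⟩
  ℕ→ℚ (risingFactorial m p) * T + E
    ≡⟨ summation-by-parts^ u (stirlingEGF-< 0<p) m p K ⟩
  risingSum m u K
    ≡⟨ rhsPartial≡risingSum p m 0<p M ⟨
  rhsPartial p n M
    ∎
  where
  open ≡-Reasoning
  n = p ℕ.+ m
  K = p ℕ.+ M
  binom = n C p
  u = stirlingEGF p
  T = risingSum n (cumsum^ p u) K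
  E = boundaryTerms u m p K
  lhsTerm-< : ∀ k → k ℕ.< p → lhsTerm p n k ≡ 0ℚ
  lhsTerm-< k k<p = begin
    W p k * inv (risingProd k n)                           ≡⟨ cong (_* inv (risingProd k n)) (W≗p!·cumsum^p-stirlingEGF p k) ⟩
    ℕ→ℚ (p !) * cumsum^ p u k * inv (risingProd k n)       ≡⟨ cong (λ x → ℕ→ℚ (p !) * x * inv (risingProd k n)) (cumsum^-stirlingEGF-< p k<p) ⟩
    ℕ→ℚ (p !) * 0ℚ * inv (risingProd k n)                  ≡⟨ cong (_* inv (risingProd k n)) (*-zeroʳ (ℕ→ℚ (p !))) ⟩
    0ℚ * inv (risingProd k n)                              ≡⟨ *-zeroˡ (inv (risingProd k n)) ⟩
    0ℚ                                                     ∎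

H-nonNeg : ∀ k → 0ℚ ≤ H k
H-nonNeg zero    = ≤-refl
H-nonNeg (suc k) = +-nonNeg (H-nonNeg k) (0≤inv (suc k))

H-mono-≤ : ∀ {j k} → j ℕ.≤ k → H j ≤ H k
H-mono-≤ {j} {k} j≤k with ℕₚ.m≤n⇒m<n∨m≡n j≤k
... | inj₂ refl        = ≤-refl
... | inj₁ (s≤s j≤k-1) = ≤-trans (H-mono-≤ j≤k-1) (p≤p+q (0≤inv k))

H^[1+r]≤[1+r]!*K : ∀ r K → H K ^ suc r ≤ ℕ→ℚ (suc r !) * ℕ→ℚ K
H^s≤s!*K : ∀ s K → 1 ℕ.≤ K → H K ^ s ≤ ℕ→ℚ (s !) * ℕ→ℚ K

H^[1+r]≤[1+r]!*K r zero    = ≤-reflexive (trans (*-zeroˡ (H 0 ^ r)) (sym (*-zeroʳ (ℕ→ℚ (suc r !)))))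
H^[1+r]≤[1+r]!*K r (suc K) = begin
  (H K + x) ^ suc r                                             ≤⟨ [x+y]^[1+r]≤x^[1+r]+[1+r]*[x+y]^r*y r (H-nonNeg K) (0≤inv (suc K)) ⟩
  H K ^ suc r + ℕ→ℚ (suc r) * (H (suc K) ^ r * x)               ≤⟨ +-mono-≤ (H^[1+r]≤[1+r]!*K r K)
                                                                     (*-monoˡ-≤-0≤ (0≤ℕ→ℚ (suc r)) (*-monoʳ-≤-0≤ (0≤inv (suc K)) (H^s≤s!*K r (suc K) (s≤s z≤n)))) ⟩
  F * ℕ→ℚ K + ℕ→ℚ (suc r) * ((ℕ→ℚ (r !) * ℕ→ℚ (suc K)) * x)    ≡⟨ ring F (ℕ→ℚ K) (ℕ→ℚ (suc r)) (ℕ→ℚ (r !)) (ℕ→ℚ (suc K)) x ⟩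
  F * ℕ→ℚ K + (ℕ→ℚ (suc r) * ℕ→ℚ (r !)) * (ℕ→ℚ (suc K) * x)    ≡⟨ cong₂ (λ a b → F * ℕ→ℚ K + a * b) (ℕ→ℚ-* (suc r) (r !)) (sym (ℕ→ℚ*inv≡1 K)) ⟨
  F * ℕ→ℚ K + F * 1ℚ                                            ≡⟨ *-distribˡ-+ F (ℕ→ℚ K) 1ℚ ⟨
  F * (ℕ→ℚ K + 1ℚ)                                              ≡⟨ cong (F *_) (trans (+-comm (ℕ→ℚ K) 1ℚ) (sym (ℕ→ℚ-suc K))) ⟩
  F * ℕ→ℚ (suc K)                                               ∎
  where
  open ≤-Reasoning
  x = inv (suc K)
  F = ℕ→ℚ (suc r !)
  ring : ∀ F k c f K x → F * k + c * ((f * K) * x) ≡ F * k + (c * f) * (K * x)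
  ring = solve-∀ ℚ-ring

H^s≤s!*K zero    K 1≤K = ≤-trans (ℕ→ℚ-mono-≤ 1≤K) (≤-reflexive (sym (*-identityˡ (ℕ→ℚ K))))
H^s≤s!*K (suc r) K _   = H^[1+r]≤[1+r]!*K r K

-- By the recurrence, [y+1, q+1]/y! is the elementary symmetric sum e_q(1, 1/2, …, 1/y) ≤ H_y^q.
stirling1≤y!*H^q : ∀ y q → ℕ→ℚ (stirling1 (suc y) (suc q)) ≤ ℕ→ℚ (y !) * H y ^ q
stirling1≤y!*H^q zero    zero    = ≤-refl
stirling1≤y!*H^q zero    (suc q) = *-nonNeg (0≤ℕ→ℚ 1) (^-nonNeg (suc q) (H-nonNeg 0))
stirling1≤y!*H^q (suc y) zero    = begin
  ℕ→ℚ (suc y ℕ.* s ℕ.+ 0)          ≡⟨ cong ℕ→ℚ (ℕₚ.+-identityʳ (suc y ℕ.* s)) ⟩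
  ℕ→ℚ (suc y ℕ.* s)                ≡⟨ ℕ→ℚ-* (suc y) s ⟩
  Y * ℕ→ℚ s                        ≤⟨ *-monoˡ-≤-0≤ (0≤ℕ→ℚ (suc y)) (stirling1≤y!*H^q y zero) ⟩
  Y * (ℕ→ℚ (y !) * 1ℚ)             ≡⟨ *-assoc Y (ℕ→ℚ (y !)) 1ℚ ⟨
  Y * ℕ→ℚ (y !) * 1ℚ               ≡⟨ cong (_* 1ℚ) (ℕ→ℚ-* (suc y) (y !)) ⟨
  ℕ→ℚ (suc y !) * 1ℚ               ∎
  where
  open ≤-Reasoning
  Y = ℕ→ℚ (suc y)
  s = stirling1 (suc y) 1
stirling1≤y!*H^q (suc y) (suc q) = begin
  ℕ→ℚ (suc y ℕ.* s ℕ.+ s′)                       ≡⟨ trans (ℕ→ℚ-+ (suc y ℕ.* s) s′) (cong (_+ ℕ→ℚ s′) (ℕ→ℚ-* (suc y) s)) ⟩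
  Y * ℕ→ℚ s + ℕ→ℚ s′                             ≤⟨ +-mono-≤ (*-monoˡ-≤-0≤ (0≤ℕ→ℚ (suc y)) (stirling1≤y!*H^q y (suc q))) (stirling1≤y!*H^q y q) ⟩
  Y * (F * h ^ suc q) + F * h ^ q                ≡⟨ cong (Y * (F * h ^ suc q) +_) (*-identityʳ (F * h ^ q)) ⟨
  Y * (F * h ^ suc q) + F * h ^ q * 1ℚ           ≡⟨ cong (λ z → Y * (F * h ^ suc q) + F * h ^ q * z) (ℕ→ℚ*inv≡1 y) ⟨
  Y * (F * h ^ suc q) + F * h ^ q * (Y * x)      ≡⟨ ring Y F (h ^ suc q) (h ^ q) x ⟩
  (Y * F) * (h ^ suc q + h ^ q * x)              ≤⟨ *-monoˡ-≤-0≤ (*-nonNeg (0≤ℕ→ℚ (suc y)) (0≤ℕ→ℚ (y !)))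
                                                                 (x^[1+r]+x^r*y≤[x+y]^[1+r] q (H-nonNeg y) (0≤inv (suc y))) ⟩
  (Y * F) * (h + x) ^ suc q                      ≡⟨ cong (_* (h + x) ^ suc q) (ℕ→ℚ-* (suc y) (y !)) ⟨
  ℕ→ℚ (suc y !) * H (suc y) ^ suc q              ∎
  where
  open ≤-Reasoning
  Y = ℕ→ℚ (suc y)
  F = ℕ→ℚ (y !)
  h = H y
  x = inv (suc y)
  s = stirling1 (suc y) (suc (suc q))
  s′ = stirling1 (suc y) (suc q)
  ring : ∀ Y F a b x → Y * (F * a) + F * b * (Y * x) ≡ (Y * F) * (a + b * x)
  ring = solve-∀ ℚ-ring

ℕ→ℚ[n!]*inv[n!]≡1 : ∀ n → ℕ→ℚ (n !) * inv (n !) ≡ 1ℚ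
ℕ→ℚ[n!]*inv[n!]≡1 n with n ! | ℕₚ.1≤n! n
... | suc m | _ = ℕ→ℚ*inv≡1 m

stirlingEGF≤H^q*inv : ∀ q y → stirlingEGF (suc q) (suc y) ≤ H y ^ q * inv (suc y)
stirlingEGF≤H^q*inv q y = begin
  ℕ→ℚ (stirling1 (suc y) (suc q)) * inv (suc y ℕ.* y !)  ≤⟨ *-monoʳ-≤-0≤ (0≤inv (suc y ℕ.* y !)) (stirling1≤y!*H^q y q) ⟩
  (F * H y ^ q) * inv (suc y ℕ.* y !)                    ≡⟨ cong ((F * H y ^ q) *_) (inv-* (suc y) (y !)) ⟩
  (F * H y ^ q) * (inv (suc y) * inv (y !))              ≡⟨ ring F (H y ^ q) (inv (suc y)) (inv (y !)) ⟩
  (H y ^ q * inv (suc y)) * (F * inv (y !))              ≡⟨ cong ((H y ^ q * inv (suc y)) *_) (ℕ→ℚ[n!]*inv[n!]≡1 y) ⟩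
  (H y ^ q * inv (suc y)) * 1ℚ                           ≡⟨ *-identityʳ (H y ^ q * inv (suc y)) ⟩
  H y ^ q * inv (suc y)                                  ∎
  where
  open ≤-Reasoning
  F = ℕ→ℚ (y !)
  ring : ∀ F a b c → (F * a) * (b * c) ≡ (a * b) * (F * c)
  ring = solve-∀ ℚ-ring

archimedean : ∀ ε → 0ℚ < ε → ∃[ N ] (inv (suc N) < ε)
archimedean (mkℚ (ℤ.+ suc a) d _) _ = suc d , toℚᵘ-cancel-<
  (ℚᵘₚ.<-respˡ-≃ (ℚᵘₚ.≃-sym (toℚᵘ-inv (suc d))) (ℚᵘ.*<* (ℤ.+<+ (s≤s (s≤s (ℕₚ.+-monoʳ-≤ d z≤n))))))
archimedean (mkℚ (ℤ.+ 0) d _)      (*<* (ℤ.+<+ ()))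
archimedean (mkℚ ℤ.-[1+ a ] d _)   (*<* ())

half : ℚ → ℚ
half ε = ε * inv 2

half+half≡id : ∀ ε → half ε + half ε ≡ ε
half+half≡id ε = trans (sym (*-distribˡ-+ ε (inv 2) (inv 2))) (*-identityʳ ε)

0<half : ∀ {ε} → 0ℚ < ε → 0ℚ < half ε
0<half {ε} 0<ε = subst (_< ε * inv 2) (*-zeroˡ (inv 2)) (*-monoˡ-<-pos (inv 2) {{positive (0<inv[1+m] 1)}} 0<ε)

-- One-sided: only eventual upper bounds are required, as all sequences below are nonnegative.
TendsToZero : (ℕ → ℚ) → Set
TendsToZero f = ∀ ε → 0ℚ < ε → ∃[ N ] (∀ K → N ℕ.≤ K → f K < ε)

tendsToZero-inv : TendsToZero inv
tendsToZero-inv ε 0<ε with archimedean ε 0<ε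
... | N , inv<ε = suc N , λ { (suc K) N<K → ≤-<-trans (inv-antimono-≤ (s≤s z≤n) N<K) inv<ε }

tendsToZero-≤ : ∀ {f g : ℕ → ℚ} → (∀ K → 1 ℕ.≤ K → f K ≤ g K) → TendsToZero g → TendsToZero f
tendsToZero-≤ f≤g g→0 ε 0<ε with g→0 ε 0<ε
... | N , g<ε = suc N , λ K N<K → ≤-<-trans (f≤g K (ℕₚ.≤-trans (s≤s z≤n) N<K)) (g<ε K (ℕₚ.<⇒≤ N<K))

tendsToZero-+ : ∀ {f g : ℕ → ℚ} → TendsToZero f → TendsToZero g → TendsToZero (λ K → f K + g K)
tendsToZero-+ {f} {g} f→0 g→0 ε 0<ε with f→0 (half ε) (0<half 0<ε) | g→0 (half ε) (0<half 0<ε)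
... | N₁ , f<ε/2 | N₂ , g<ε/2 = N₁ ℕ.⊔ N₂ , λ K N≤K → subst (f K + g K <_) (half+half≡id ε)
  (+-mono-< (f<ε/2 K (ℕₚ.≤-trans (ℕₚ.m≤m⊔n N₁ N₂) N≤K)) (g<ε/2 K (ℕₚ.≤-trans (ℕₚ.m≤n⊔m N₁ N₂) N≤K)))

tendsToZero-* : ∀ {f : ℕ → ℚ} c → (∀ K → 0ℚ ≤ f K) → TendsToZero f → TendsToZero (λ K → ℕ→ℚ c * f K)
tendsToZero-* {f} c 0≤f f→0 ε 0<ε with f→0 (ε * inv (suc c)) 0<ε/[1+c]
  where 0<ε/[1+c] = subst (_< ε * inv (suc c)) (*-zeroˡ (inv (suc c))) (*-monoˡ-<-pos (inv (suc c)) {{positive (0<inv[1+m] c)}} 0<ε)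
... | N , f<ε/[1+c] = N , λ K N≤K → begin-strict
  ℕ→ℚ c * f K                        ≤⟨ *-monoʳ-≤-0≤ (0≤f K) (ℕ→ℚ-mono-≤ (ℕₚ.n≤1+n c)) ⟩
  ℕ→ℚ (suc c) * f K                  <⟨ *-monoʳ-<-pos (ℕ→ℚ (suc c)) {{positive 0<1+c}} (f<ε/[1+c] K N≤K) ⟩
  ℕ→ℚ (suc c) * (ε * inv (suc c))    ≡⟨ ring (ℕ→ℚ (suc c)) ε (inv (suc c)) ⟩
  ε * (ℕ→ℚ (suc c) * inv (suc c))    ≡⟨ cong (ε *_) (ℕ→ℚ*inv≡1 c) ⟩
  ε * 1ℚ                             ≡⟨ *-identityʳ ε ⟩
  ε                                  ∎
  where
  open ≤-Reasoning
  0<1+c = positive⁻¹ (ℕ→ℚ (suc c)) {{normalize-pos (suc c) 1}}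
  ring : ∀ a b c → a * (b * c) ≡ b * (a * c)
  ring = solve-∀ ℚ-ring

tendsToZero-shift : ∀ {f : ℕ → ℚ} a → TendsToZero f → TendsToZero (λ K → f (a ℕ.+ K))
tendsToZero-shift a f→0 ε 0<ε with f→0 ε 0<ε
... | N , f<ε = N , λ K N≤K → f<ε (a ℕ.+ K) (ℕₚ.≤-trans N≤K (ℕₚ.m≤n+m K a))

x*x<y*y⇒x<y : ∀ {x y} → 0ℚ ≤ x → 0ℚ ≤ y → x * x < y * y → x < y
x*x<y*y⇒x<y {x} {y} 0≤x 0≤y x²<y² with y ≤? x
... | yes y≤x = ⊥-elim (<-irrefl refl (<-≤-trans x²<y² (*-mono-≤-0≤ 0≤y 0≤y y≤x y≤x)))
... | no  y≰x = ≰⇒> y≰x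

[H^r*inv]²≤[r+r]!*inv : ∀ r K → (H (suc K) ^ r * inv (suc K)) * (H (suc K) ^ r * inv (suc K)) ≤ ℕ→ℚ ((r ℕ.+ r) !) * inv (suc K)
[H^r*inv]²≤[r+r]!*inv r K = begin
  (h ^ r * x) * (h ^ r * x)         ≡⟨ ring₁ (h ^ r) x ⟩
  (h ^ r * h ^ r) * (x * x)         ≡⟨ cong (_* (x * x)) (^-homo-* h r r) ⟨
  h ^ (r ℕ.+ r) * (x * x)           ≤⟨ *-monoʳ-≤-0≤ (*-nonNeg (0≤inv (suc K)) (0≤inv (suc K))) (H^s≤s!*K (r ℕ.+ r) (suc K) (s≤s z≤n)) ⟩
  (F * ℕ→ℚ (suc K)) * (x * x)       ≡⟨ ring₂ F (ℕ→ℚ (suc K)) x ⟩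
  (F * x) * (ℕ→ℚ (suc K) * x)       ≡⟨ cong ((F * x) *_) (ℕ→ℚ*inv≡1 K) ⟩
  (F * x) * 1ℚ                      ≡⟨ *-identityʳ (F * x) ⟩
  F * x                             ∎
  where
  open ≤-Reasoning
  h = H (suc K)
  x = inv (suc K)
  F = ℕ→ℚ ((r ℕ.+ r) !)
  ring₁ : ∀ a b → (a * b) * (a * b) ≡ (a * a) * (b * b)
  ring₁ = solve-∀ ℚ-ring
  ring₂ : ∀ F k i → (F * k) * (i * i) ≡ (F * i) * (k * i)
  ring₂ = solve-∀ ℚ-ring

-- H_K ^ 2r ≤ (2r)! K, so (H_K ^ r / K)² ≤ (2r)!/K.
tendsToZero-H^r*inv : ∀ r → TendsToZero (λ K → H K ^ r * inv K)
tendsToZero-H^r*inv r ε 0<ε = square-root (tendsToZero-* ((r ℕ.+ r) !) 0≤inv tendsToZero-inv (ε * ε) 0<ε²)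
  where
  0<ε² : 0ℚ < ε * ε
  0<ε² = subst (_< ε * ε) (*-zeroˡ ε) (*-monoˡ-<-pos ε {{positive 0<ε}} 0<ε)
  square-root : ∃[ N ] (∀ K → N ℕ.≤ K → ℕ→ℚ ((r ℕ.+ r) !) * inv K < ε * ε) → ∃[ N ] (∀ K → N ℕ.≤ K → H K ^ r * inv K < ε)
  square-root (N , below) = suc N , λ where
    (suc K) N<K → x*x<y*y⇒x<y (*-nonNeg (^-nonNeg r (H-nonNeg (suc K))) (0≤inv (suc K))) (<⇒≤ 0<ε)
                    (≤-<-trans ([H^r*inv]²≤[r+r]!*inv r K) (below (suc K) (ℕₚ.<⇒≤ N<K)))

risingProd-zeroˡ : ∀ m → risingProd 0 m ≡ 0
risingProd-zeroˡ zero    = refl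
risingProd-zeroˡ (suc m) = cong (ℕ._* suc m) (risingProd-zeroˡ m)

k≤risingProd : ∀ k m → k ℕ.≤ risingProd k m
k≤risingProd k zero    = ℕₚ.≤-refl
k≤risingProd k (suc m) = ℕₚ.≤-trans (k≤risingProd k m)
  (subst (λ x → risingProd k m ℕ.≤ risingProd k m ℕ.* x) (sym (ℕₚ.+-suc k m)) (ℕₚ.m≤m*n (risingProd k m) (suc (k ℕ.+ m))))

inv-risingProd≤inv : ∀ k m → inv (risingProd k m) ≤ inv k
inv-risingProd≤inv zero    m = ≤-reflexive (cong inv (risingProd-zeroˡ m))
inv-risingProd≤inv (suc k) m = inv-antimono-≤ (s≤s z≤n) (k≤risingProd (suc k) m)

stirlingEGF-nonNeg : ∀ p k → 0ℚ ≤ stirlingEGF p k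
stirlingEGF-nonNeg p k = *-nonNeg (0≤ℕ→ℚ (stirling1 k p)) (0≤inv (k !))

cumsum^-nonNeg : ∀ j {a} → (∀ k → 0ℚ ≤ a k) → ∀ k → 0ℚ ≤ cumsum^ j a k
cumsum^-nonNeg zero    0≤a = 0≤a
cumsum^-nonNeg (suc j) 0≤a k = partialSum-nonNeg _ (suc k) (cumsum^-nonNeg j 0≤a)

partialSum-inv≤H : ∀ K → partialSum inv K ≤ H K
partialSum-inv≤H zero    = ≤-refl
partialSum-inv≤H (suc K) = ≤-trans (≤-reflexive (sym (H≗cumsum-inv K))) (H-mono-≤ (ℕₚ.n≤1+n K))


boundaryTerm-nonNeg : ∀ {a} → (∀ k → 0ℚ ≤ a k) → ∀ m j K → 0ℚ ≤ boundaryTerm a m j K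
boundaryTerm-nonNeg 0≤a m j K = *-nonNeg (partialSum-nonNeg _ K (cumsum^-nonNeg j 0≤a)) (0≤inv (risingProd K (j ℕ.+ m)))

boundaryTerms-nonNeg : ∀ {a} → (∀ k → 0ℚ ≤ a k) → ∀ m j K → 0ℚ ≤ boundaryTerms a m j K
boundaryTerms-nonNeg 0≤a m zero    K = ≤-refl
boundaryTerms-nonNeg 0≤a m (suc j) K =
  +-nonNeg (boundaryTerms-nonNeg 0≤a m j K) (*-nonNeg (0≤ℕ→ℚ (risingFactorial m j)) (boundaryTerm-nonNeg 0≤a m j K))

-- A further cumsum multiplies the partial sum by at most K, the extra factor of the rising product divides by at least K.
boundaryTerm-suc≤ : ∀ {a} → (∀ k → 0ℚ ≤ a k) → ∀ m j K → boundaryTerm a m (suc j) K ≤ boundaryTerm a m j K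
boundaryTerm-suc≤ {a} 0≤a m j zero    =
  ≤-reflexive (trans (*-zeroˡ (inv (risingProd 0 (suc j ℕ.+ m)))) (sym (*-zeroˡ (inv (risingProd 0 (j ℕ.+ m))))))
boundaryTerm-suc≤ {a} 0≤a m j (suc k) = begin
  partialSum (cumsum^ (suc j) a) K * inv (risingProd K (suc j ℕ.+ m))  ≤⟨ *-mono-≤-0≤ (partialSum-nonNeg _ K (cumsum^-nonNeg (suc j) 0≤a))
                                                                                     (0≤inv (risingProd K (suc j ℕ.+ m))) sum≤ inv≤ ⟩
  (ℕ→ℚ K * P) * (r * inv K)                                            ≡⟨ ring (ℕ→ℚ K) P r (inv K) ⟩
  (P * r) * (ℕ→ℚ K * inv K)                                            ≡⟨ cong ((P * r) *_) (ℕ→ℚ*inv≡1 k) ⟩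
  (P * r) * 1ℚ                                                         ≡⟨ *-identityʳ (P * r) ⟩
  P * r                                                                ∎
  where
  open ≤-Reasoning
  K = suc k
  P = partialSum (cumsum^ j a) K
  r = inv (risingProd K (j ℕ.+ m))
  sum≤ : partialSum (cumsum^ (suc j) a) K ≤ ℕ→ℚ K * P
  sum≤ = partialSum≤M*bound (cumsum^ (suc j) a) P K (λ i i<K → partialSum-monoʳ-≤ (cumsum^ j a) (cumsum^-nonNeg j 0≤a) i<K)
  inv≤ : inv (risingProd K (suc j ℕ.+ m)) ≤ r * inv K
  inv≤ = ≤-trans (≤-reflexive (inv-* (risingProd K (j ℕ.+ m)) (K ℕ.+ suc (j ℕ.+ m))))
                 (*-monoˡ-≤-0≤ (0≤inv (risingProd K (j ℕ.+ m))) (inv-antimono-≤ (s≤s z≤n) (ℕₚ.m≤m+n K (suc (j ℕ.+ m)))))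
  ring : ∀ k P r i → (k * P) * (r * i) ≡ (P * r) * (k * i)
  ring = solve-∀ ℚ-ring

boundaryTerm-stirlingEGF≤ : ∀ q m j K → boundaryTerm (stirlingEGF (suc q)) m j K ≤ H K ^ suc q * inv K
boundaryTerm-stirlingEGF≤ q m (suc j) K =
  ≤-trans (boundaryTerm-suc≤ (stirlingEGF-nonNeg (suc q)) m j K) (boundaryTerm-stirlingEGF≤ q m j K)
boundaryTerm-stirlingEGF≤ q m zero K = begin
  partialSum u K * inv (risingProd K m)       ≤⟨ *-mono-≤-0≤ (partialSum-nonNeg u K (stirlingEGF-nonNeg (suc q))) (0≤inv (risingProd K m))
                                                             sum≤ (inv-risingProd≤inv K m) ⟩
  (H K ^ q * H K) * inv K                     ≡⟨ cong (_* inv K) (*-comm (H K ^ q) (H K)) ⟩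
  H K ^ suc q * inv K                         ∎
  where
  open ≤-Reasoning
  u = stirlingEGF (suc q)
  term≤ : ∀ k → k ℕ.< K → u k ≤ H K ^ q * inv k
  term≤ zero    _     = ≤-trans (≤-reflexive (stirlingEGF-< {0} {suc q} (s≤s z≤n))) (*-nonNeg (^-nonNeg q (H-nonNeg K)) (0≤inv 0))
  term≤ (suc k) 1+k<K = ≤-trans (stirlingEGF≤H^q*inv q k)
    (*-monoʳ-≤-0≤ (0≤inv (suc k)) (^-mono-≤ q (H-nonNeg k) (H-mono-≤ (ℕₚ.≤-trans (ℕₚ.n≤1+n k) (ℕₚ.<⇒≤ 1+k<K)))))
  sum≤ : partialSum u K ≤ H K ^ q * H K
  sum≤ = begin
    partialSum u K                          ≤⟨ partialSum-mono-≤ u (λ k → H K ^ q * inv k) K term≤ ⟩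
    partialSum (λ k → H K ^ q * inv k) K    ≡⟨ partialSum-*ˡ (H K ^ q) inv K ⟩
    H K ^ q * partialSum inv K              ≤⟨ *-monoˡ-≤-0≤ (^-nonNeg q (H-nonNeg K)) (partialSum-inv≤H K) ⟩
    H K ^ q * H K                           ∎

tendsToZero-boundaryTerms : ∀ q m j → TendsToZero (boundaryTerms (stirlingEGF (suc q)) m j)
tendsToZero-boundaryTerms q m zero    ε 0<ε = 0 , λ _ _ → 0<ε
tendsToZero-boundaryTerms q m (suc j) = tendsToZero-+ (tendsToZero-boundaryTerms q m j)
  (tendsToZero-* (risingFactorial m j) (boundaryTerm-nonNeg (stirlingEGF-nonNeg (suc q)) m j)
    (tendsToZero-≤ (λ K _ → boundaryTerm-stirlingEGF≤ q m j K) (tendsToZero-H^r*inv (suc q))))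

abel-summation : ∀ (f w : ℕ → ℚ) j →
  partialSum (λ i → f i * (w i - w (suc i))) j + f j * w j ≡ f 0 * w 0 + partialSum (λ i → (f (suc i) - f i) * w (suc i)) j
abel-summation f w zero    = trans (+-identityˡ (f 0 * w 0)) (sym (+-identityʳ (f 0 * w 0)))
abel-summation f w (suc j) = begin
  (S + f j * (w j - w (suc j))) + f (suc j) * w (suc j)     ≡⟨ ring S (f j) (f (suc j)) (w j) (w (suc j)) ⟩
  (S + f j * w j) + (f (suc j) - f j) * w (suc j)           ≡⟨ cong (_+ (f (suc j) - f j) * w (suc j)) (abel-summation f w j) ⟩
  (f 0 * w 0 + T) + (f (suc j) - f j) * w (suc j)           ≡⟨ +-assoc (f 0 * w 0) T ((f (suc j) - f j) * w (suc j)) ⟩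
  f 0 * w 0 + (T + (f (suc j) - f j) * w (suc j))           ∎
  where
  open ≡-Reasoning
  S = partialSum (λ i → f i * (w i - w (suc i))) j
  T = partialSum (λ i → (f (suc i) - f i) * w (suc i)) j
  ring : ∀ s f f′ w w′ → (s + f * (w + - w′)) + f′ * w′ ≡ (s + f * w) + (f′ + - f) * w′
  ring = solve-∀ ℚ-ring

inv[1+k]-inv[2+k]≡inv[1+k]*inv[2+k] : ∀ k → inv (suc k) - inv (suc (suc k)) ≡ inv (suc k) * inv (suc (suc k))
inv[1+k]-inv[2+k]≡inv[1+k]*inv[2+k] k = sym (begin
  a * b                          ≡⟨ *-identityʳ (a * b) ⟨
  a * b * 1ℚ                     ≡⟨ cong (a * b *_) (1+n-n≡1 (ℕ→ℚ (suc k))) ⟨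
  a * b * ((1ℚ + N) - N)         ≡⟨ cong (λ x → a * b * (x - N)) (ℕ→ℚ-suc (suc k)) ⟨
  a * b * (ℕ→ℚ (suc (suc k)) - N) ≡⟨ ring₂ a b (ℕ→ℚ (suc (suc k))) N ⟩
  a * (ℕ→ℚ (suc (suc k)) * b) - (N * a) * b ≡⟨ cong₂ (λ x y → a * x - y * b) (ℕ→ℚ*inv≡1 (suc k)) (ℕ→ℚ*inv≡1 k) ⟩
  a * 1ℚ - 1ℚ * b                ≡⟨ cong₂ _-_ (*-identityʳ a) (*-identityˡ b) ⟩
  a - b                          ∎)
  where
  open ≡-Reasoning
  a = inv (suc k)
  b = inv (suc (suc k))
  N = ℕ→ℚ (suc k)
  1+n-n≡1 : ∀ n → (1ℚ + n) - n ≡ 1ℚ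
  1+n-n≡1 n = trans (+-assoc 1ℚ n (- n)) (trans (cong (1ℚ +_) (+-inverseʳ n)) (+-identityʳ 1ℚ))
  ring₂ : ∀ a b n₂ n₁ → a * b * (n₂ + - n₁) ≡ a * (n₂ * b) + - ((n₁ * a) * b)
  ring₂ = solve-∀ ℚ-ring

inv[1+k]*inv[1+k]≤2*[inv[1+k]-inv[2+k]] : ∀ k → inv (suc k) * inv (suc k) ≤ ℕ→ℚ 2 * (inv (suc k) - inv (suc (suc k)))
inv[1+k]*inv[1+k]≤2*[inv[1+k]-inv[2+k]] k = begin
  a * a                  ≡⟨ cong (a *_) a≡ab+b ⟩
  a * (a * b + b)        ≤⟨ *-monoˡ-≤-0≤ (0≤inv (suc k)) (+-monoˡ-≤ b (*-monoʳ-≤-0≤ (0≤inv (suc (suc k))) a≤1)) ⟩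
  a * (1ℚ * b + b)       ≡⟨ ring a b ⟩
  ℕ→ℚ 2 * (a * b)        ≡⟨ cong (ℕ→ℚ 2 *_) (inv[1+k]-inv[2+k]≡inv[1+k]*inv[2+k] k) ⟨
  ℕ→ℚ 2 * (a - b)        ∎
  where
  open ≤-Reasoning
  a = inv (suc k)
  b = inv (suc (suc k))
  a≤1 : a ≤ 1ℚ
  a≤1 = inv-antimono-≤ {1} {suc k} (s≤s z≤n) (s≤s z≤n)
  a≡ab+b : a ≡ a * b + b
  a≡ab+b = trans (sym (ring₁ a b)) (cong (_+ b) (inv[1+k]-inv[2+k]≡inv[1+k]*inv[2+k] k))
    where ring₁ : ∀ a b → (a + - b) + b ≡ a
          ring₁ = solve-∀ ℚ-ring
  ring : ∀ a b → a * (1ℚ * b + b) ≡ (1ℚ + 1ℚ) * (a * b)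
  ring = solve-∀ ℚ-ring

p≤q+r⇒p-q≤r : ∀ {p q r} → p ≤ q + r → p - q ≤ r
p≤q+r⇒p-q≤r {p} {q} {r} p≤q+r = ≤-trans (+-monoˡ-≤ (- q) p≤q+r) (≤-reflexive (ring q r))
  where ring : ∀ q r → (q + r) + - q ≡ r
        ring = solve-∀ ℚ-ring

[H[1+k]^[1+q]-H[k]^[1+q]]*inv[1+k]≤ : ∀ q k →
  (H (suc k) ^ suc q - H k ^ suc q) * inv (suc k) ≤ ℕ→ℚ (suc q) * (ℕ→ℚ 2 * (H (suc k) ^ q * (inv (suc k) - inv (suc (suc k)))))
[H[1+k]^[1+q]-H[k]^[1+q]]*inv[1+k]≤ q k = begin
  (H (suc k) ^ suc q - H k ^ suc q) * x    ≤⟨ *-monoʳ-≤-0≤ (0≤inv (suc k))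
                                                (p≤q+r⇒p-q≤r ([x+y]^[1+r]≤x^[1+r]+[1+r]*[x+y]^r*y q (H-nonNeg k) (0≤inv (suc k)))) ⟩
  c * (h ^ q * x) * x                      ≡⟨ ring₁ c (h ^ q) x ⟩
  c * (h ^ q * (x * x))                    ≤⟨ *-monoˡ-≤-0≤ (0≤ℕ→ℚ (suc q)) (*-monoˡ-≤-0≤ (^-nonNeg q (H-nonNeg (suc k)))
                                                (inv[1+k]*inv[1+k]≤2*[inv[1+k]-inv[2+k]] k)) ⟩
  c * (h ^ q * (ℕ→ℚ 2 * (x - x′)))         ≡⟨ cong (c *_) (ring₂ (h ^ q) (ℕ→ℚ 2) (x - x′)) ⟩
  c * (ℕ→ℚ 2 * (h ^ q * (x - x′)))         ∎
  where
  open ≤-Reasoning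
  c = ℕ→ℚ (suc q)
  h = H (suc k)
  x = inv (suc k)
  x′ = inv (suc (suc k))
  ring₁ : ∀ c t x → c * (t * x) * x ≡ c * (t * (x * x))
  ring₁ = solve-∀ ℚ-ring
  ring₂ : ∀ t c d → t * (c * d) ≡ c * (t * d)
  ring₂ = solve-∀ ℚ-ring

tailSum : ℕ → ℕ → ℕ → ℚ
tailSum q a j = partialSum (λ i → H (i ℕ.+ a) ^ q * (inv (i ℕ.+ a) - inv (suc i ℕ.+ a))) j

-- Abel summation against 1/k - 1/(k+1), using H_{k+1}^(q+1) - H_k^(q+1) ≲ (q+1) H_{k+1}^q / (k+1).
tailBound : ℕ → ℕ → ℚ
tailBound zero    a = inv a
tailBound (suc q) a = H a ^ suc q * inv a + ℕ→ℚ (suc q) * (ℕ→ℚ 2 * tailBound q (suc a))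

tailBound-nonNeg : ∀ q a → 0ℚ ≤ tailBound q a
tailBound-nonNeg zero    a = 0≤inv a
tailBound-nonNeg (suc q) a = +-nonNeg (*-nonNeg (^-nonNeg (suc q) (H-nonNeg a)) (0≤inv a))
                                      (*-nonNeg (0≤ℕ→ℚ (suc q)) (*-nonNeg (0≤ℕ→ℚ 2) (tailBound-nonNeg q (suc a))))

tendsToZero-tailBound : ∀ q → TendsToZero (tailBound q)
tendsToZero-tailBound zero    = tendsToZero-inv
tendsToZero-tailBound (suc q) = tendsToZero-+ (tendsToZero-H^r*inv (suc q))
  (tendsToZero-* (suc q) (λ K → *-nonNeg (0≤ℕ→ℚ 2) (tailBound-nonNeg q (suc K)))
    (tendsToZero-* 2 (λ K → tailBound-nonNeg q (suc K)) (tendsToZero-shift 1 (tendsToZero-tailBound q))))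

tailSum≤tailBound : ∀ q a j → tailSum q a j ≤ tailBound q a
tailSum≤tailBound zero a j = begin
  tailSum 0 a j                                                  ≤⟨ p≤p+q (*-nonNeg (^-nonNeg 0 (H-nonNeg a)) (0≤inv (j ℕ.+ a))) ⟩
  tailSum 0 a j + 1ℚ * w j                                       ≡⟨ abel-summation (λ _ → 1ℚ) w j ⟩
  1ℚ * inv a + partialSum (λ i → (1ℚ - 1ℚ) * w (suc i)) j        ≡⟨ cong₂ _+_ (*-identityˡ (inv a)) (partialSum-≡0 _ j (λ i _ → 1-1≡0 (w (suc i)))) ⟩
  inv a + 0ℚ                                                     ≡⟨ +-identityʳ (inv a) ⟩
  inv a                                                          ∎
  where
  open ≤-Reasoning
  w = λ i → inv (i ℕ.+ a)
  1-1≡0 : ∀ x → (1ℚ - 1ℚ) * x ≡ 0ℚ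
  1-1≡0 x = trans (cong (_* x) (+-inverseʳ 1ℚ)) (*-zeroˡ x)
tailSum≤tailBound (suc q) a j = begin
  tailSum (suc q) a j                                            ≤⟨ p≤p+q (*-nonNeg (^-nonNeg (suc q) (H-nonNeg (j ℕ.+ a))) (0≤inv (j ℕ.+ a))) ⟩
  tailSum (suc q) a j + f j * w j                                ≡⟨ abel-summation f w j ⟩
  f 0 * w 0 + partialSum (λ i → (f (suc i) - f i) * w (suc i)) j ≤⟨ +-monoʳ-≤ (f 0 * w 0) (partialSum-mono-≤ _ _ j (λ i _ → increment≤ i)) ⟩
  f 0 * w 0 + partialSum (λ i → c * (ℕ→ℚ 2 * g i)) j            ≡⟨ cong (f 0 * w 0 +_) (trans (partialSum-*ˡ c (λ i → ℕ→ℚ 2 * g i) j)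
                                                                                               (cong (c *_) (partialSum-*ˡ (ℕ→ℚ 2) g j))) ⟩
  f 0 * w 0 + c * (ℕ→ℚ 2 * tailSum q (suc a) j)                 ≤⟨ +-monoʳ-≤ (f 0 * w 0) (*-monoˡ-≤-0≤ (0≤ℕ→ℚ (suc q))
                                                                     (*-monoˡ-≤-0≤ (0≤ℕ→ℚ 2) (tailSum≤tailBound q (suc a) j))) ⟩
  tailBound (suc q) a                                            ∎
  where
  open ≤-Reasoning
  c = ℕ→ℚ (suc q)
  f = λ i → H (i ℕ.+ a) ^ suc q
  w = λ i → inv (i ℕ.+ a)
  g = λ i → H (i ℕ.+ suc a) ^ q * (inv (i ℕ.+ suc a) - inv (suc i ℕ.+ suc a))
  increment≤ : ∀ i → (f (suc i) - f i) * w (suc i) ≤ c * (ℕ→ℚ 2 * g i)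
  increment≤ i = subst (λ k → (f (suc i) - f i) * w (suc i) ≤ c * (ℕ→ℚ 2 * (H k ^ q * (inv k - inv (suc k)))))
                       (sym (ℕₚ.+-suc i a)) ([H[1+k]^[1+q]-H[k]^[1+q]]*inv[1+k]≤ q (i ℕ.+ a))

∣p-q∣<ε : ∀ {p q ε} → p < q + ε → q < p + ε → ∣ p - q ∣ < ε
∣p-q∣<ε {p} {q} {ε} p<q+ε q<p+ε with ∣p∣≡p∨∣p∣≡-p (p - q)
... | inj₁ ∣p-q∣≡p-q = subst (_< ε) (sym ∣p-q∣≡p-q) (subst (p - q <_) (ring₁ q ε) (+-monoˡ-< (- q) p<q+ε))
  where ring₁ : ∀ q ε → (q + ε) + - q ≡ ε
        ring₁ = solve-∀ ℚ-ring
... | inj₂ ∣p-q∣≡q-p = subst (_< ε) (sym ∣p-q∣≡q-p) (subst₂ _<_ (ring₂ p q) (ring₃ p ε) (+-monoˡ-< (- p) q<p+ε))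
  where ring₂ : ∀ p q → q + - p ≡ - (p + - q)
        ring₂ = solve-∀ ℚ-ring
        ring₃ : ∀ p ε → (p + ε) + - p ≡ ε
        ring₃ = solve-∀ ℚ-ring

Cauchy⁺ : (ℕ → ℚ) → Set
Cauchy⁺ s = ∀ ε → 0ℚ < ε → ∃[ N ] (∀ a b → N ℕ.≤ a → N ℕ.≤ b → s a < s b + ε)

Cauchy⁺⇒Cauchy : ∀ {s} → Cauchy⁺ s → Cauchy s
Cauchy⁺⇒Cauchy s-cauchy ε 0<ε with s-cauchy ε 0<ε
... | N , s<s+ε = N , λ a b N≤a N≤b → ∣p-q∣<ε (s<s+ε a b N≤a N≤b) (s<s+ε b a N≤b N≤a)

p<p+ε : ∀ {p ε} → 0ℚ < ε → p < p + ε
p<p+ε {p} 0<ε = subst (_< p + _) (+-identityʳ p) (+-monoʳ-< p 0<ε)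

cauchy⁺-monotone : ∀ {s τ : ℕ → ℚ} → (∀ {a b} → a ℕ.≤ b → s a ≤ s b) → (∀ {a b} → a ℕ.≤ b → s b ≤ s a + τ a) →
  TendsToZero τ → Cauchy⁺ s
cauchy⁺-monotone {s} {τ} s-mono s-tail τ→0 ε 0<ε with τ→0 ε 0<ε
... | N , τ<ε = N , close
  where
  close : ∀ a b → N ℕ.≤ a → N ℕ.≤ b → s a < s b + ε
  close a b N≤a N≤b with ℕₚ.≤-total a b
  ... | inj₁ a≤b = ≤-<-trans (s-mono a≤b) (p<p+ε 0<ε)
  ... | inj₂ b≤a = ≤-<-trans (s-tail b≤a) (+-monoʳ-< (s b) (τ<ε b N≤b))

cauchy⁺-+ : ∀ {s e t : ℕ → ℚ} → (∀ M → s M + e M ≡ t M) → (∀ M → 0ℚ ≤ e M) → TendsToZero e → Cauchy⁺ t → Cauchy⁺ s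
cauchy⁺-+ {s} {e} {t} s+e≡t 0≤e e→0 t-cauchy ε 0<ε
  with t-cauchy (half ε) (0<half 0<ε) | e→0 (half ε) (0<half 0<ε)
... | N₁ , t<t+ε/2 | N₂ , e<ε/2 = N₁ ℕ.⊔ N₂ , λ a b N≤a N≤b → begin-strict
  s a                            ≤⟨ p≤p+q (0≤e a) ⟩
  s a + e a                      ≡⟨ s+e≡t a ⟩
  t a                            <⟨ t<t+ε/2 a b (ℕₚ.≤-trans (ℕₚ.m≤m⊔n N₁ N₂) N≤a) (ℕₚ.≤-trans (ℕₚ.m≤m⊔n N₁ N₂) N≤b) ⟩
  t b + half ε                   ≡⟨ cong (_+ half ε) (s+e≡t b) ⟨
  (s b + e b) + half ε           <⟨ +-monoˡ-< (half ε) (+-monoʳ-< (s b) (e<ε/2 b (ℕₚ.≤-trans (ℕₚ.m≤n⊔m N₁ N₂) N≤b))) ⟩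
  (s b + half ε) + half ε        ≡⟨ trans (+-assoc (s b) (half ε) (half ε)) (cong (s b +_) (half+half≡id ε)) ⟩
  s b + ε                        ∎
  where open ≤-Reasoning

sameLimit-+ : ∀ {s e t : ℕ → ℚ} → (∀ M → s M + e M ≡ t M) → (∀ M → 0ℚ ≤ e M) → TendsToZero e → SameLimit s t
sameLimit-+ {s} {e} {t} s+e≡t 0≤e e→0 ε 0<ε with e→0 ε 0<ε
... | N , e<ε = N , λ M N≤M → ∣p-q∣<ε {s M} {t M}
  (≤-<-trans (≤-trans (p≤p+q (0≤e M)) (≤-reflexive (s+e≡t M))) (p<p+ε 0<ε))
  (subst (_< s M + ε) (s+e≡t M) (+-monoʳ-< (s M) (e<ε M N≤M)))

stirlingEGF*inv-risingProd≤ : ∀ q m k → 0 ℕ.< k →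
  stirlingEGF (suc q) k * inv (risingProd k m) ≤ ℕ→ℚ 2 * (H k ^ q * (inv k - inv (suc k)))
stirlingEGF*inv-risingProd≤ q m (suc y) _ = begin
  stirlingEGF (suc q) k * inv (risingProd k m)   ≤⟨ *-mono-≤-0≤ (stirlingEGF-nonNeg (suc q) k) (0≤inv (risingProd k m))
                                                               (stirlingEGF≤H^q*inv q y) (inv-risingProd≤inv k m) ⟩
  H y ^ q * x * x                                ≤⟨ *-monoʳ-≤-0≤ (0≤inv k) (*-monoʳ-≤-0≤ (0≤inv k) (^-mono-≤ q (H-nonNeg y) (H-mono-≤ (ℕₚ.n≤1+n y)))) ⟩
  H k ^ q * x * x                                ≡⟨ *-assoc (H k ^ q) x x ⟩
  H k ^ q * (x * x)                              ≤⟨ *-monoˡ-≤-0≤ (^-nonNeg q (H-nonNeg k)) (inv[1+k]*inv[1+k]≤2*[inv[1+k]-inv[2+k]] y) ⟩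
  H k ^ q * (ℕ→ℚ 2 * (x - inv (suc k)))          ≡⟨ ring (H k ^ q) (ℕ→ℚ 2) (x - inv (suc k)) ⟩
  ℕ→ℚ 2 * (H k ^ q * (x - inv (suc k)))          ∎
  where
  open ≤-Reasoning
  k = suc y
  x = inv k
  ring : ∀ t c d → t * (c * d) ≡ c * (t * d)
  ring = solve-∀ ℚ-ring

risingSum-stirlingEGF-tail : ∀ q m K d → 0 ℕ.< K →
  risingSum m (stirlingEGF (suc q)) (K ℕ.+ d) ≤ risingSum m (stirlingEGF (suc q)) K + ℕ→ℚ 2 * tailBound q K
risingSum-stirlingEGF-tail q m K d 0<K = begin
  partialSum t (K ℕ.+ d)                                 ≡⟨ partialSum-split t K d ⟩
  partialSum t K + partialSum (λ i → t (K ℕ.+ i)) d      ≤⟨ +-monoʳ-≤ (partialSum t K) (partialSum-mono-≤ _ _ d term≤) ⟩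
  partialSum t K + partialSum (λ i → ℕ→ℚ 2 * g i) d      ≡⟨ cong (partialSum t K +_) (partialSum-*ˡ (ℕ→ℚ 2) g d) ⟩
  partialSum t K + ℕ→ℚ 2 * tailSum q K d                 ≤⟨ +-monoʳ-≤ (partialSum t K) (*-monoˡ-≤-0≤ (0≤ℕ→ℚ 2) (tailSum≤tailBound q K d)) ⟩
  partialSum t K + ℕ→ℚ 2 * tailBound q K                 ∎
  where
  open ≤-Reasoning
  t = λ k → stirlingEGF (suc q) k * inv (risingProd k m)
  g = λ i → H (i ℕ.+ K) ^ q * (inv (i ℕ.+ K) - inv (suc i ℕ.+ K))
  term≤ : ∀ i → i ℕ.< d → t (K ℕ.+ i) ≤ ℕ→ℚ 2 * g i
  term≤ i _ rewrite ℕₚ.+-comm K i = stirlingEGF*inv-risingProd≤ q m (i ℕ.+ K) (ℕₚ.<-≤-trans 0<K (ℕₚ.m≤n+m K i))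

convergence : ∀ q m →
  Cauchy (lhsPartial (suc q) (suc q ℕ.+ m)) × Cauchy (rhsPartial (suc q) (suc q ℕ.+ m))
    × SameLimit (lhsPartial (suc q) (suc q ℕ.+ m)) (rhsPartial (suc q) (suc q ℕ.+ m))
convergence q m =
  Cauchy⁺⇒Cauchy (cauchy⁺-+ {lhs} identity 0≤E E→0 rhs-cauchy) , Cauchy⁺⇒Cauchy rhs-cauchy , sameLimit-+ {lhs} identity 0≤E E→0
  where
  p = suc q
  u = stirlingEGF p
  lhs = lhsPartial p (p ℕ.+ m)
  E = λ M → boundaryTerms u m p (p ℕ.+ M)
  identity : ∀ M → lhsPartial p (p ℕ.+ m) M + E M ≡ rhsPartial p (p ℕ.+ m) M
  identity = lhsPartial+boundaryTerms≡rhsPartial p m (s≤s z≤n)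
  0≤E : ∀ M → 0ℚ ≤ E M
  0≤E M = boundaryTerms-nonNeg (stirlingEGF-nonNeg p) m p (p ℕ.+ M)
  E→0 : TendsToZero E
  E→0 = tendsToZero-shift p (tendsToZero-boundaryTerms q m p)
  rhs≡ = rhsPartial≡risingSum p m (s≤s z≤n)
  rhs-mono : ∀ {a b} → a ℕ.≤ b → rhsPartial p (p ℕ.+ m) a ≤ rhsPartial p (p ℕ.+ m) b
  rhs-mono {a} {b} a≤b = subst₂ _≤_ (sym (rhs≡ a)) (sym (rhs≡ b))
    (partialSum-monoʳ-≤ _ (λ k → *-nonNeg (stirlingEGF-nonNeg p k) (0≤inv (risingProd k m))) (ℕₚ.+-monoʳ-≤ p a≤b))
  rhs-tail : ∀ {a b} → a ℕ.≤ b → rhsPartial p (p ℕ.+ m) b ≤ rhsPartial p (p ℕ.+ m) a + ℕ→ℚ 2 * tailBound q (p ℕ.+ a)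
  rhs-tail {a} {b} a≤b = subst₂ (λ x y → x ≤ y + ℕ→ℚ 2 * tailBound q (p ℕ.+ a)) (sym (rhs≡ b)) (sym (rhs≡ a))
    (subst (λ K → risingSum m u K ≤ risingSum m u (p ℕ.+ a) + ℕ→ℚ 2 * tailBound q (p ℕ.+ a))
           (trans (ℕₚ.+-assoc p a (b ∸ a)) (cong (p ℕ.+_) (ℕₚ.m+[n∸m]≡n a≤b)))
           (risingSum-stirlingEGF-tail q m (p ℕ.+ a) (b ∸ a) (s≤s z≤n)))
  rhs-cauchy : Cauchy⁺ (rhsPartial p (p ℕ.+ m))
  rhs-cauchy = cauchy⁺-monotone rhs-mono rhs-tail
    (tendsToZero-* 2 (λ M → tailBound-nonNeg q (p ℕ.+ M)) (tendsToZero-shift p (tendsToZero-tailBound q)))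

corollary5p4 : (p n : ℕ) → 2 ℕ.≤ p → p ℕ.≤ n →
    Cauchy (lhsPartial p n) × Cauchy (rhsPartial p n)
      × SameLimit (lhsPartial p n) (rhsPartial p n)
corollary5p4 (suc q) n _ p≤n = subst (λ n → Cauchy (lhsPartial (suc q) n) × Cauchy (rhsPartial (suc q) n)
                                               × SameLimit (lhsPartial (suc q) n) (rhsPartial (suc q) n))
                                     (ℕₚ.m+[n∸m]≡n p≤n) (convergence q (n ∸ suc q))
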